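{- For all $n,k\geq1$, the number of permutations $\pi\in\mathfrak{J}_n$ whose last letter $\pi_n$ equals $k$ is the Entringer number $E_{n,k}$. Consequently, the distribution of the last letter over $\mathfrak{J}_n$ equals the distribution of the first letter over the up-down permutations in $\mathfrak{S}_n$, and also equals the distribution of the first letter over the André permutations in $\mathfrak{S}_n$.
   Context: A permutation of a finite set $S$ of positive integers is a word in which each element of $S$ appears exactly once; $\mathfrak{S}_n$ is the set of permutations of $\{1,\dots,n\}$. For a permutation $\pi$ and a letter $x$ of $\pi$, $\rho_\pi(x)$ is the maximal consecutive subword of $\pi$ consisting of the letters immediately to the right of $x$ that are all larger than $x$. $\pi$ is Jacobi if $|\rho_\pi(x)|$ is even for all letters $x$; $\mathfrak{J}_n$ is the set of Jacobi permutations in $\mathfrak{S}_n$. A permutation $\pi$ is up-down if $\pi_1<\pi_2>\pi_3<\pi_4>\cdots$. The Entringer number $E_{n,k}$ is the number of up-down permutations $\pi\in\mathfrak{S}_n$ with $\pi_1=k$. André permutations are defined recursively: the empty permutation is André; for nonempty $S$ with $y=\min S$, a permutation $\pi=\alpha y\beta$ of $S$ is André if $\alpha$ and $\beta$ are André and the largest letter of the concatenation $\alpha\beta$ lies in $\beta$. -}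

module Defs where

open import Data.Bool using (Bool; true; false; _∧_; not; if_then_else_)
open import Data.Nat using (ℕ; zero; suc; _<ᵇ_; _≡ᵇ_; _≤ᵇ_; _⊓_; _⊔_; _%_)
open import Data.List using (List; []; _∷_; _++_; length; map; concatMap; applyUpTo; filter; foldr)
open import Relation.Nullary.Decidable using (yes; no)
open import Relation.Binary.PropositionalEquality using (_≡_)
import Data.Bool as B

-- Words are lists of positive integers.  A permutation of {1,…,n} is a
-- word of length n, all of whose letters lie in {1,…,n}, and whose
-- letters are pairwise distinct.

elemᵇ : ℕ → List ℕ → Bool
elemᵇ x []       = false
elemᵇ x (y ∷ ys) = (x ≡ᵇ y) B.∨ elemᵇ x ys

distinctᵇ : List ℕ → Bool
distinctᵇ []       = true
distinctᵇ (x ∷ xs) = not (elemᵇ x xs) ∧ distinctᵇ xs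

oneTo : ℕ → List ℕ
oneTo n = applyUpTo suc n

words : ℕ → ℕ → List (List ℕ)
words n zero    = [] ∷ []
words n (suc l) = concatMap (λ v → map (v ∷_) (words n l)) (oneTo n)

perms : ℕ → List (List ℕ)
perms n = filter (λ w → B.T? (distinctᵇ w)) (words n n)

countPerms : ℕ → (List ℕ → Bool) → ℕ
countPerms n P = length (filter (λ w → B.T? (P w)) (perms n))

firstIs : ℕ → List ℕ → Bool
firstIs k []      = false
firstIs k (x ∷ _) = x ≡ᵇ k

lastIs : ℕ → List ℕ → Bool
lastIs k []           = false
lastIs k (x ∷ [])     = x ≡ᵇ k
lastIs k (_ ∷ y ∷ ys) = lastIs k (y ∷ ys)

-- Jacobi permutations.
-- rhoLen x rest = |ρ_π(x)| where rest is the part of π to the right of x: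
-- the length of the maximal initial run of rest consisting of letters > x.

rhoLen : ℕ → List ℕ → ℕ
rhoLen x []       = zero
rhoLen x (y ∷ ys) = if x <ᵇ y then suc (rhoLen x ys) else zero

evenᵇ : ℕ → Bool
evenᵇ zero          = true
evenᵇ (suc zero)    = false
evenᵇ (suc (suc n)) = evenᵇ n

jacobiᵇ : List ℕ → Bool
jacobiᵇ []       = true
jacobiᵇ (x ∷ xs) = evenᵇ (rhoLen x xs) ∧ jacobiᵇ xs

alt : Bool → List ℕ → Bool
alt b []           = true
alt b (x ∷ [])     = true
alt true  (x ∷ y ∷ ys) = (x <ᵇ y) ∧ alt false (y ∷ ys)
alt false (x ∷ y ∷ ys) = (y <ᵇ x) ∧ alt true (y ∷ ys)

upDownᵇ : List ℕ → Bool
upDownᵇ = alt true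

entringer : ℕ → ℕ → ℕ
entringer n k = countPerms n (λ π → upDownᵇ π ∧ firstIs k π)

-- André permutations (recursive definition, with a fuel argument that
-- is always at least the length of the word).

minimumOf : ℕ → List ℕ → ℕ
minimumOf x xs = foldr _⊓_ x xs

maximumOf : ℕ → List ℕ → ℕ
maximumOf x xs = foldr _⊔_ x xs

record Split : Set where
  constructor _,_
  field
    before : List ℕ
    after  : List ℕ

splitOn : ℕ → List ℕ → Split
splitOn y []       = [] , []
splitOn y (x ∷ xs) with x ≡ᵇ y
... | true  = [] , xs
... | false = let s = splitOn y xs in (x ∷ Split.before s) , Split.after s

largestInβ : List ℕ → List ℕ → Bool
largestInβ α β with α ++ β
... | []     = true
... | z ∷ zs = elemᵇ (maximumOf z zs) β

andreF : ℕ → List ℕ → Bool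
andreF _        []       = true
andreF zero     (_ ∷ _)  = false
andreF (suc f)  (x ∷ xs) =
  let y = minimumOf x xs
      s = splitOn y (x ∷ xs)
  in andreF f (Split.before s) ∧ andreF f (Split.after s)
     ∧ largestInβ (Split.before s) (Split.after s)

andreᵇ : List ℕ → Bool
andreᵇ π = andreF (length π) π

-- Cut a permutation of a finite set S at its least letter m, as α m β.  It is
-- Jacobi iff α and β are Jacobi and |β| is even; it is up-down iff α is up-down
-- of even length and β is down-up; it is André iff α and β are André and the
-- largest letter of S lies in β.  The first letter of α m β is that of α (or m),
-- the last one that of β (or m).  Summing over the ordered bipartitions (A, R) of
-- S ∖ {m} turns each characterisation into a recurrence for the number of such
-- permutations, refined by a condition on the first (resp. last) letter.  After
-- exchanging A and R, Jacobi permutations counted by last letter and up-down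
-- permutations counted by first letter satisfy the same recurrence, because
-- up-down and down-up permutations are equinumerous (cut the latter at their
-- maximum).  For André permutations one cuts again at M = max S: an exchange
-- over the splittings of S ∖ {m, M} into three blocks shows that up-down
-- permutations satisfy the André recurrence as well.

module Submission where

open import Defs
open import Data.Nat using (ℕ; _≥_)
open import Data.Bool using (_∧_)
open import Data.Product using (_×_)
open import Relation.Binary.PropositionalEquality using (_≡_)

open import Data.Bool using (Bool; true; false; not; if_then_else_; T; T?)
open import Data.Bool.Properties using (T-≡; ¬-not; ∧-zeroʳ; ∧-assoc; ∧-identityʳ; ∨-zeroʳ; not-involutive)
open import Data.Bool.Solver using (module ∨-∧-Solver)
open import Data.Empty using (⊥-elim)
open import Data.List using (List; []; _∷_; _++_; length; map; concatMap; filter; null)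
import Data.List.Properties as List
open import Data.List.Membership.Propositional using (_∈_; _∉_; find; lose)
open import Data.List.Membership.Propositional.Properties
  using (∈-map⁺; ∈-map⁻; ∈-++⁺ˡ; ∈-++⁺ʳ; ∈-++⁻; ∈-∃++; ∈-concatMap⁺; ∈-concatMap⁻; ∈-filter⁺; ∈-filter⁻)
open import Data.List.Membership.Propositional.Properties.WithK using (unique∧set⇒bag)
open import Data.List.Relation.Binary.BagAndSetEquality using (∼bag⇒↭)
open import Data.List.Relation.Binary.Disjoint.Propositional using (Disjoint)
open import Data.List.Relation.Binary.Permutation.Propositional
  using (_↭_; ↭-refl; ↭-reflexive; ↭-sym; ↭-trans; ↭-prep; ↭-swap; ↭⇒↭ₛ)
import Data.List.Relation.Binary.Permutation.Propositional.Properties as ↭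
import Data.List.Relation.Binary.Permutation.Setoid.Properties as ↭ₛ
open import Data.List.Relation.Unary.All using (All; []; _∷_)
import Data.List.Relation.Unary.All as All
import Data.List.Relation.Unary.All.Properties as All
open import Data.List.Relation.Unary.Any using (here; there)
import Data.List.Relation.Unary.Any as Any
open import Data.List.Relation.Unary.Unique.Propositional using (Unique; []; _∷_; tail)
import Data.List.Relation.Unary.Unique.Propositional.Properties as Unique
open import Data.Nat using (zero; suc; _+_; _*_; _≤_; _<_; _≡ᵇ_; _<ᵇ_; _⊓_; z≤n; s≤s; s≤s⁻¹)
open import Data.Nat.ListAction using (sum)
open import Data.Nat.ListAction.Properties using (sum-++; sum-↭)
open import Data.Nat.Properties
open import Data.Nat.Tactic.RingSolver using (solve-∀)
open import Data.List.Membership.DecPropositional _≟_ using (_∈?_)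
open import Data.Product using (_,_; proj₁; proj₂; ∃; ∃₂; map₁; map₂; swap)
open import Data.Sum using (_⊎_; inj₁; inj₂; [_,_]′)
open import Function using (_∘_; _⇔_; mk⇔; const; Equivalence)
open import Relation.Binary.Definitions using (Trichotomous; Transitive; tri<; tri≈; tri>)
import Relation.Binary.Construct.Flip.EqAndOrd as Flip
open import Relation.Binary.PropositionalEquality
  using (refl; sym; trans; cong; cong₂; subst; setoid; _≢_; module ≡-Reasoning)
open import Relation.Nullary using (yes; no)
open import Algebra.Properties.CommutativeSemigroup +-commutativeSemigroup using (interchange)

open ≡-Reasoning

∑ : {A : Set} → List A → (A → ℕ) → ℕ
∑ xs f = sum (map f xs)

⟦_⟧ : Bool → ℕ
⟦ false ⟧ = 0
⟦ true  ⟧ = 1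

⟦∧⟧ : ∀ a b → ⟦ a ∧ b ⟧ ≡ ⟦ a ⟧ * ⟦ b ⟧
⟦∧⟧ false b = refl
⟦∧⟧ true  b = sym (+-identityʳ ⟦ b ⟧)

⟦¬b⟧*v+⟦b⟧*v≡v : ∀ b v → ⟦ not b ⟧ * v + ⟦ b ⟧ * v ≡ v
⟦¬b⟧*v+⟦b⟧*v≡v false v = trans (+-identityʳ (v + 0)) (+-identityʳ v)
⟦¬b⟧*v+⟦b⟧*v≡v true  v = +-identityʳ v

module _ {A : Set} where

  ∑-++ : ∀ (xs ys : List A) f → ∑ (xs ++ ys) f ≡ ∑ xs f + ∑ ys f
  ∑-++ xs ys f = trans (cong sum (List.map-++ f xs ys)) (sum-++ (map f xs) (map f ys))

  ∑-map : ∀ {B : Set} (g : B → A) xs f → ∑ (map g xs) f ≡ ∑ xs (f ∘ g)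
  ∑-map g xs f = cong sum (sym (List.map-∘ xs))

  ∑-concatMap : ∀ {B : Set} (g : B → List A) xs f → ∑ (concatMap g xs) f ≡ ∑ xs (λ x → ∑ (g x) f)
  ∑-concatMap g []       f = refl
  ∑-concatMap g (x ∷ xs) f = trans (∑-++ (g x) (concatMap g xs) f) (cong (∑ (g x) f +_) (∑-concatMap g xs f))

  ∑-cong : ∀ (xs : List A) {f g} → (∀ {x} → x ∈ xs → f x ≡ g x) → ∑ xs f ≡ ∑ xs g
  ∑-cong []       f≗g = refl
  ∑-cong (x ∷ xs) f≗g = cong₂ _+_ (f≗g (here refl)) (∑-cong xs (f≗g ∘ there))

  ∑-zero : ∀ (xs : List A) {f} → (∀ {x} → x ∈ xs → f x ≡ 0) → ∑ xs f ≡ 0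
  ∑-zero []       f≗0 = refl
  ∑-zero (x ∷ xs) f≗0 = cong₂ _+_ (f≗0 (here refl)) (∑-zero xs (f≗0 ∘ there))

  ∑-+ : ∀ (xs : List A) f g → ∑ xs (λ x → f x + g x) ≡ ∑ xs f + ∑ xs g
  ∑-+ []       f g = refl
  ∑-+ (x ∷ xs) f g = trans (cong (f x + g x +_) (∑-+ xs f g)) (interchange (f x) (g x) (∑ xs f) (∑ xs g))

  ∑-*ˡ : ∀ c (xs : List A) f → c * ∑ xs f ≡ ∑ xs (λ x → c * f x)
  ∑-*ˡ c []       f = *-zeroʳ c
  ∑-*ˡ c (x ∷ xs) f = trans (*-distribˡ-+ c (f x) _) (cong (c * f x +_) (∑-*ˡ c xs f))

  ∑-*ʳ : ∀ c (xs : List A) f → ∑ xs f * c ≡ ∑ xs (λ x → f x * c)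
  ∑-*ʳ c []       f = refl
  ∑-*ʳ c (x ∷ xs) f = trans (*-distribʳ-+ c (f x) _) (cong (f x * c +_) (∑-*ʳ c xs f))

  ∑-↭ : ∀ {xs ys : List A} → xs ↭ ys → ∀ f → ∑ xs f ≡ ∑ ys f
  ∑-↭ xs↭ys f = sum-↭ (↭.map⁺ f xs↭ys)

  ∑-unique-cong : ∀ {xs ys : List A} → Unique xs → Unique ys → (∀ {z} → z ∈ xs ⇔ z ∈ ys) →
                  ∀ f → ∑ xs f ≡ ∑ ys f
  ∑-unique-cong ux uy xs⇔ys = ∑-↭ (∼bag⇒↭ (unique∧set⇒bag ux uy xs⇔ys))

module _ {X : Set} where

  Unique-resp-↭ : ∀ {xs ys : List X} → xs ↭ ys → Unique xs → Unique ys
  Unique-resp-↭ xs↭ys = ↭ₛ.Unique-resp-↭ (setoid X) (↭⇒↭ₛ xs↭ys)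

  Unique-++⁻ : ∀ (xs : List X) {ys} → Unique (xs ++ ys) → Unique xs × Unique ys
  Unique-++⁻ []       u        = [] , u
  Unique-++⁻ (x ∷ xs) (x∉ ∷ u) = map₁ (All.++⁻ˡ xs x∉ ∷_) (Unique-++⁻ xs u)

  ∉-++-∷-injective : ∀ {x : X} α α′ {β β′} → x ∉ α → x ∉ α′ →
                     α ++ x ∷ β ≡ α′ ++ x ∷ β′ → α ≡ α′ × β ≡ β′
  ∉-++-∷-injective []      []       _   _    refl = refl , refl
  ∉-++-∷-injective []      (_ ∷ _)  _   x∉α′ refl = ⊥-elim (x∉α′ (here refl))
  ∉-++-∷-injective (_ ∷ _) []       x∉α _    refl = ⊥-elim (x∉α (here refl))
  ∉-++-∷-injective (a ∷ α) (_ ∷ α′) x∉α x∉α′ eq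
    with refl , eq′ ← List.∷-injective eq
    with refl , refl ← ∉-++-∷-injective α α′ (x∉α ∘ there) (x∉α′ ∘ there) eq′
    = refl , refl

  ⊆-length⇒↭ : ∀ {xs ys : List X} → Unique xs → All (_∈ ys) xs → length ys ≤ length xs → xs ↭ ys
  ⊆-length⇒↭ {[]}     {[]}       _          _               _    = ↭-refl
  ⊆-length⇒↭ {x ∷ xs} (x≢xs ∷ u) (x∈ys ∷ xs⊆ys) |ys|≤
    with ys₁ , ys₂ , refl ← ∈-∃++ x∈ys
    = ↭-trans (↭-prep x (⊆-length⇒↭ u (All.zipWith drop-x (x≢xs , xs⊆ys)) |ys₁++ys₂|≤))
              (↭-sym (↭.shift x ys₁ ys₂))
    where
    drop-x : ∀ {z} → x ≢ z × z ∈ ys₁ ++ x ∷ ys₂ → z ∈ ys₁ ++ ys₂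
    drop-x (x≢z , z∈) with ∈-++⁻ ys₁ z∈
    ... | inj₁ z∈ys₁         = ∈-++⁺ˡ z∈ys₁
    ... | inj₂ (here refl)   = ⊥-elim (x≢z refl)
    ... | inj₂ (there z∈ys₂) = ∈-++⁺ʳ ys₁ z∈ys₂
    |ys₁++ys₂|≤ : length (ys₁ ++ ys₂) ≤ length xs
    |ys₁++ys₂|≤ = s≤s⁻¹ (subst (_≤ suc (length xs)) (List.length-++-sucʳ ys₁ x ys₂) |ys|≤)

  module _ {_≺_ : X → X → Set} (compare : Trichotomous _≡_ _≺_) (≺-trans : Transitive _≺_) where

    extract-least : ∀ {x xs} → Unique (x ∷ xs) → ∃₂ λ m S → x ∷ xs ↭ m ∷ S × All (m ≺_) S
    extract-least {x} {[]}    _ = x , [] , ↭-refl , []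
    extract-least {x} {_ ∷ _} (x≢xs ∷ u) with m , S , xs↭ , m≺S ← extract-least u with compare x m
    ... | tri< x≺m _ _ = x , _ , ↭-refl , ↭.All-resp-↭ (↭-sym xs↭) (x≺m ∷ All.map (≺-trans x≺m) m≺S)
    ... | tri≈ _ x≡m _ = ⊥-elim (All.lookup x≢xs (↭.∈-resp-↭ (↭-sym xs↭) (here refl)) x≡m)
    ... | tri> _ _ m≺x = m , x ∷ S , ↭-trans (↭-prep x xs↭) (↭-swap x m ↭-refl) , m≺x ∷ m≺S

Unique-concatMap⁺ : ∀ {Y Z : Set} {g : Y → List Z} {ys} → Unique ys → (∀ {y} → y ∈ ys → Unique (g y)) →
                    (∀ {y y′ w} → y ∈ ys → y′ ∈ ys → w ∈ g y → w ∈ g y′ → y ≡ y′) →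
                    Unique (concatMap g ys)
Unique-concatMap⁺ {ys = []}     _ _ _ = []
Unique-concatMap⁺ {g = g} {ys = y ∷ ys} (y∉ys ∷ u) unique-g shared =
  Unique.++⁺ (unique-g (here refl)) (Unique-concatMap⁺ u (unique-g ∘ there) (λ i j → shared (there i) (there j)))
    disjoint
  where
  disjoint : Disjoint (g y) (concatMap g ys)
  disjoint (w∈gy , w∈rest) with y′ , y′∈ys , w∈gy′ ← find (∈-concatMap⁻ g w∈rest) =
    All.lookup y∉ys y′∈ys (shared (here refl) (there y′∈ys) w∈gy w∈gy′)

extract-minimum : ∀ {x xs} → Unique (x ∷ xs) → ∃₂ λ m S → x ∷ xs ↭ m ∷ S × All (m <_) S
extract-minimum = extract-least <-cmp <-trans

extract-maximum : ∀ {x xs} → Unique (x ∷ xs) → ∃₂ λ M S → x ∷ xs ↭ M ∷ S × All (_< M) S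
extract-maximum = extract-least (Flip.compare _<_ <-cmp) (Flip.trans _<_ <-trans)

module _ {X : Set} where

  bipartitions : List X → List (List X × List X)
  bipartitions []       = ([] , []) ∷ []
  bipartitions (x ∷ xs) = map (map₁ (x ∷_)) (bipartitions xs) ++ map (map₂ (x ∷_)) (bipartitions xs)

  ∈-bipartitions-∷⁻ : ∀ x xs {q} → q ∈ bipartitions (x ∷ xs) →
    (∃ λ p → p ∈ bipartitions xs × q ≡ map₁ (x ∷_) p) ⊎
    (∃ λ p → p ∈ bipartitions xs × q ≡ map₂ (x ∷_) p)
  ∈-bipartitions-∷⁻ x xs q∈ with ∈-++⁻ (map (map₁ (x ∷_)) (bipartitions xs)) q∈
  ... | inj₁ q∈₁ = inj₁ (∈-map⁻ (map₁ (x ∷_)) q∈₁)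
  ... | inj₂ q∈₂ = inj₂ (∈-map⁻ (map₂ (x ∷_)) q∈₂)

  ∈-bipartitions-∷⁺ˡ : ∀ x xs {p} → p ∈ bipartitions xs → map₁ (x ∷_) p ∈ bipartitions (x ∷ xs)
  ∈-bipartitions-∷⁺ˡ x xs p∈ = ∈-++⁺ˡ (∈-map⁺ _ p∈)

  ∈-bipartitions-∷⁺ʳ : ∀ x xs {p} → p ∈ bipartitions xs → map₂ (x ∷_) p ∈ bipartitions (x ∷ xs)
  ∈-bipartitions-∷⁺ʳ x xs p∈ = ∈-++⁺ʳ (map (map₁ (x ∷_)) (bipartitions xs)) (∈-map⁺ _ p∈)

  bipartition-↭ : ∀ S {A R} → (A , R) ∈ bipartitions S → A ++ R ↭ S
  bipartition-↭ []      (here refl) = ↭-refl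
  bipartition-↭ (x ∷ S) q∈ with ∈-bipartitions-∷⁻ x S q∈
  ... | inj₁ ((A , R) , p∈ , refl) = ↭-prep x (bipartition-↭ S p∈)
  ... | inj₂ ((A , R) , p∈ , refl) = ↭-trans (↭.shift x A R) (↭-prep x (bipartition-↭ S p∈))

  bipartition-length : ∀ S {A R} → (A , R) ∈ bipartitions S → length A + length R ≡ length S
  bipartition-length S {A} {R} q∈ = trans (sym (List.length-++ A {R})) (↭.↭-length (bipartition-↭ S q∈))

  bipartition-↭-length : ∀ S {A R α β} → (A , R) ∈ bipartitions S → α ↭ A → β ↭ R →
                         length α + length β ≡ length S
  bipartition-↭-length S q∈ α↭A β↭R =
    trans (cong₂ _+_ (↭.↭-length α↭A) (↭.↭-length β↭R)) (bipartition-length S q∈)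

  bipartition-length-≤ : ∀ S {A R n} → length S ≤ n → (A , R) ∈ bipartitions S → length A ≤ n × length R ≤ n
  bipartition-length-≤ S {A} |S|≤n q∈ = m+n≤o⇒m≤o (length A) |A|+|R|≤n , m+n≤o⇒n≤o (length A) |A|+|R|≤n
    where
    |A|+|R|≤n = ≤-trans (≤-reflexive (bipartition-length S q∈)) |S|≤n

  ∈-bipartition₁ : ∀ S {A R y} → (A , R) ∈ bipartitions S → y ∈ A → y ∈ S
  ∈-bipartition₁ S q∈ y∈A = ↭.∈-resp-↭ (bipartition-↭ S q∈) (∈-++⁺ˡ y∈A)

  bipartition-All : ∀ {P : X → Set} S {A R} → All P S → (A , R) ∈ bipartitions S → All P A × All P R
  bipartition-All S {A} PS q∈ = All.++⁻ A (↭.All-resp-↭ (↭-sym (bipartition-↭ S q∈)) PS)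

  bipartition-All-↭ : ∀ {P : X → Set} S {A R α β} → All P S → (A , R) ∈ bipartitions S → α ↭ A → β ↭ R →
                      All P α × All P β
  bipartition-All-↭ S PS q∈ α↭A β↭R =
    ↭.All-resp-↭ (↭-sym α↭A) (proj₁ (bipartition-All S PS q∈)) ,
    ↭.All-resp-↭ (↭-sym β↭R) (proj₂ (bipartition-All S PS q∈))

  bipartition-Unique : ∀ S {A R} → Unique S → (A , R) ∈ bipartitions S → Unique A × Unique R
  bipartition-Unique S {A} uS q∈ = Unique-++⁻ A (Unique-resp-↭ (↭-sym (bipartition-↭ S q∈)) uS)

  bipartitions-complete : ∀ S {α β} → α ++ β ↭ S → ∃₂ λ A R → (A , R) ∈ bipartitions S × α ↭ A × β ↭ R
  bipartitions-complete [] {[]} {[]}    _    = [] , [] , here refl , ↭-refl , ↭-refl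
  bipartitions-complete [] {[]} {_ ∷ _} αβ↭[] with () ← ↭.↭-empty-inv αβ↭[]
  bipartitions-complete [] {_ ∷ _}      αβ↭[] with () ← ↭.↭-empty-inv αβ↭[]
  bipartitions-complete (y ∷ S) {α} {β} αβ↭ with ∈-++⁻ α (↭.∈-resp-↭ (↭-sym αβ↭) (here refl))
  ... | inj₁ y∈α
    with α₁ , α₂ , refl ← ∈-∃++ y∈α
    with A , R , q∈ , α↭A , β↭R ← bipartitions-complete S
           (↭-trans (↭-reflexive (List.++-assoc α₁ α₂ β))
             (↭.drop-mid α₁ [] (↭-trans (↭-reflexive (sym (List.++-assoc α₁ (y ∷ α₂) β))) αβ↭)))
    = y ∷ A , R , ∈-bipartitions-∷⁺ˡ y S q∈ , ↭-trans (↭.shift y α₁ α₂) (↭-prep y α↭A) , β↭R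
  ... | inj₂ y∈β
    with β₁ , β₂ , refl ← ∈-∃++ y∈β
    with A , R , q∈ , α↭A , β↭R ← bipartitions-complete S
           (↭-trans (↭-reflexive (sym (List.++-assoc α β₁ β₂)))
             (↭.drop-mid (α ++ β₁) [] (↭-trans (↭-reflexive (List.++-assoc α β₁ (y ∷ β₂))) αβ↭)))
    = A , y ∷ R , ∈-bipartitions-∷⁺ʳ y S q∈ , α↭A , ↭-trans (↭.shift y β₁ β₂) (↭-prep y β↭R)

  bipartitions-unique : ∀ {S} → Unique S → Unique (bipartitions S)
  bipartitions-unique {[]}     _          = [] ∷ []
  bipartitions-unique {x ∷ xs} (x∉xs ∷ u) =
    Unique.++⁺ (Unique.map⁺ map₁-injective (bipartitions-unique u))
               (Unique.map⁺ map₂-injective (bipartitions-unique u)) disjoint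
    where
    map₁-injective : ∀ {p q : List X × List X} → map₁ (x ∷_) p ≡ map₁ (x ∷_) q → p ≡ q
    map₁-injective refl = refl
    map₂-injective : ∀ {p q : List X × List X} → map₂ (x ∷_) p ≡ map₂ (x ∷_) q → p ≡ q
    map₂-injective refl = refl
    disjoint : Disjoint (map (map₁ (x ∷_)) (bipartitions xs)) (map (map₂ (x ∷_)) (bipartitions xs))
    disjoint (q∈₁ , q∈₂) with ∈-map⁻ _ q∈₁ | ∈-map⁻ _ q∈₂
    ... | _ , _ , refl | _ , p∈ , eq =
      All.lookup x∉xs (∈-bipartition₁ xs p∈ (subst (x ∈_) (cong proj₁ eq) (here refl))) refl

  ∈-bipartitions-injective : ∀ {S A R A′ R′} → Unique S → (A , R) ∈ bipartitions S → (A′ , R′) ∈ bipartitions S →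
                             A ↭ A′ → (A , R) ≡ (A′ , R′)
  ∈-bipartitions-injective {[]} _ (here refl) (here refl) _ = refl
  ∈-bipartitions-injective {x ∷ xs} (x∉xs ∷ u) q∈ q′∈ A↭A′
    with ∈-bipartitions-∷⁻ x xs q∈ | ∈-bipartitions-∷⁻ x xs q′∈
  ... | inj₁ (_ , p∈ , refl) | inj₁ (_ , p′∈ , refl) =
    cong (map₁ (x ∷_)) (∈-bipartitions-injective u p∈ p′∈ (↭.drop-∷ A↭A′))
  ... | inj₁ (_ , p∈ , refl) | inj₂ (_ , p′∈ , refl) =
    ⊥-elim (All.lookup x∉xs (∈-bipartition₁ xs p′∈ (↭.∈-resp-↭ A↭A′ (here refl))) refl)
  ... | inj₂ (_ , p∈ , refl) | inj₁ (_ , p′∈ , refl) =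
    ⊥-elim (All.lookup x∉xs (∈-bipartition₁ xs p∈ (↭.∈-resp-↭ (↭-sym A↭A′) (here refl))) refl)
  ... | inj₂ (_ , p∈ , refl) | inj₂ (_ , p′∈ , refl) =
    cong (map₂ (x ∷_)) (∈-bipartitions-injective u p∈ p′∈ A↭A′)

  ∑-bipartitions-∷ : ∀ x xs f → ∑ (bipartitions (x ∷ xs)) f ≡
                     ∑ (bipartitions xs) (f ∘ map₁ (x ∷_)) + ∑ (bipartitions xs) (f ∘ map₂ (x ∷_))
  ∑-bipartitions-∷ x xs f =
    trans (∑-++ (map (map₁ (x ∷_)) (bipartitions xs)) _ f)
          (cong₂ _+_ (∑-map (map₁ (x ∷_)) (bipartitions xs) f) (∑-map (map₂ (x ∷_)) (bipartitions xs) f))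

  ∑-bipartitions-swap : ∀ S f → ∑ (bipartitions S) f ≡ ∑ (bipartitions S) (f ∘ swap)
  ∑-bipartitions-swap []       f = refl
  ∑-bipartitions-swap (x ∷ xs) f = begin
    ∑ (bipartitions (x ∷ xs)) f
      ≡⟨ ∑-bipartitions-∷ x xs f ⟩
    ∑ (bipartitions xs) (f ∘ map₁ (x ∷_)) + ∑ (bipartitions xs) (f ∘ map₂ (x ∷_))
      ≡⟨ cong₂ _+_ (∑-bipartitions-swap xs _) (∑-bipartitions-swap xs _) ⟩
    ∑₂ + ∑₁
      ≡⟨ +-comm ∑₂ ∑₁ ⟩
    ∑₁ + ∑₂
      ≡⟨ ∑-bipartitions-∷ x xs (f ∘ swap) ⟨
    ∑ (bipartitions (x ∷ xs)) (f ∘ swap) ∎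
    where
    ∑₁ = ∑ (bipartitions xs) (f ∘ swap ∘ map₁ (x ∷_))
    ∑₂ = ∑ (bipartitions xs) (f ∘ swap ∘ map₂ (x ∷_))

  ∑-bipartitions-assoc : ∀ S (f : List X → List X → List X → ℕ) →
    ∑ (bipartitions S) (λ (AB , C) → ∑ (bipartitions AB) λ (A , B) → f A B C) ≡
    ∑ (bipartitions S) (λ (A , BC) → ∑ (bipartitions BC) λ (B , C) → f A B C)
  ∑-bipartitions-assoc []       f = refl
  ∑-bipartitions-assoc (x ∷ xs) f = begin
    ∑ (bipartitions (x ∷ xs)) (λ (AB , C) → ∑ (bipartitions AB) λ (A , B) → f A B C)
      ≡⟨ ∑-bipartitions-∷ x xs _ ⟩
    ∑ (bipartitions xs) (λ (AB , C) → ∑ (bipartitions (x ∷ AB)) λ (A , B) → f A B C) + ∑ˡ f₃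
      ≡⟨ cong (_+ ∑ˡ f₃) (trans (∑-cong (bipartitions xs) (λ {q} _ → ∑-bipartitions-∷ x (proj₁ q) _))
                                (∑-+ (bipartitions xs) _ _)) ⟩
    (∑ˡ f₁ + ∑ˡ f₂) + ∑ˡ f₃
      ≡⟨ +-assoc (∑ˡ f₁) (∑ˡ f₂) (∑ˡ f₃) ⟩
    ∑ˡ f₁ + (∑ˡ f₂ + ∑ˡ f₃)
      ≡⟨ cong₂ _+_ (∑-bipartitions-assoc xs f₁)
                   (cong₂ _+_ (∑-bipartitions-assoc xs f₂) (∑-bipartitions-assoc xs f₃)) ⟩
    ∑ʳ f₁ + (∑ʳ f₂ + ∑ʳ f₃)
      ≡⟨ cong (∑ʳ f₁ +_) (trans (∑-cong (bipartitions xs) (λ {q} _ → ∑-bipartitions-∷ x (proj₂ q) _))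
                                (∑-+ (bipartitions xs) _ _)) ⟨
    ∑ʳ f₁ + ∑ (bipartitions xs) (λ (A , BC) → ∑ (bipartitions (x ∷ BC)) λ (B , C) → f A B C)
      ≡⟨ ∑-bipartitions-∷ x xs _ ⟨
    ∑ (bipartitions (x ∷ xs)) (λ (A , BC) → ∑ (bipartitions BC) λ (B , C) → f A B C) ∎
    where
    ∑ˡ ∑ʳ : (List X → List X → List X → ℕ) → ℕ
    ∑ˡ g = ∑ (bipartitions xs) (λ (AB , C) → ∑ (bipartitions AB) λ (A , B) → g A B C)
    ∑ʳ g = ∑ (bipartitions xs) (λ (A , BC) → ∑ (bipartitions BC) λ (B , C) → g A B C)
    f₁ f₂ f₃ : List X → List X → List X → ℕ
    f₁ A B C = f (x ∷ A) B C
    f₂ A B C = f A (x ∷ B) C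
    f₃ A B C = f A B (x ∷ C)

  ∑-bipartitions-cong-length : ∀ S T → length S ≡ length T → ∀ {f g} →
    (∀ {A R A′ R′} → (A , R) ∈ bipartitions S → (A′ , R′) ∈ bipartitions T →
       length A ≡ length A′ → length R ≡ length R′ → f (A , R) ≡ g (A′ , R′)) →
    ∑ (bipartitions S) f ≡ ∑ (bipartitions T) g
  ∑-bipartitions-cong-length []      []      _       f≈g = cong (_+ 0) (f≈g (here refl) (here refl) refl refl)
  ∑-bipartitions-cong-length (x ∷ S) (y ∷ T) |S|≡|T| {f} {g} f≈g = begin
    ∑ (bipartitions (x ∷ S)) f
      ≡⟨ ∑-bipartitions-∷ x S f ⟩
    ∑ (bipartitions S) (f ∘ map₁ (x ∷_)) + ∑ (bipartitions S) (f ∘ map₂ (x ∷_))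
      ≡⟨ cong₂ _+_
           (∑-bipartitions-cong-length S T (suc-injective |S|≡|T|) (λ q∈ q′∈ |A|≡ |R|≡ →
              f≈g (∈-bipartitions-∷⁺ˡ x S q∈) (∈-bipartitions-∷⁺ˡ y T q′∈) (cong suc |A|≡) |R|≡))
           (∑-bipartitions-cong-length S T (suc-injective |S|≡|T|) (λ q∈ q′∈ |A|≡ |R|≡ →
              f≈g (∈-bipartitions-∷⁺ʳ x S q∈) (∈-bipartitions-∷⁺ʳ y T q′∈) |A|≡ (cong suc |R|≡))) ⟩
    ∑ (bipartitions T) (g ∘ map₁ (y ∷_)) + ∑ (bipartitions T) (g ∘ map₂ (y ∷_))
      ≡⟨ ∑-bipartitions-∷ y T g ⟨
    ∑ (bipartitions (y ∷ T)) g ∎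

module _ {X : Set} where

  joinAt : X → (List X → List (List X)) → List X × List X → List (List X)
  joinAt x P (A , R) = concatMap (λ α → map (λ β → α ++ x ∷ β) (P R)) (P A)

  ∈-joinAt⁻ : ∀ x P A R {w} → w ∈ joinAt x P (A , R) →
              ∃₂ λ α β → α ∈ P A × β ∈ P R × w ≡ α ++ x ∷ β
  ∈-joinAt⁻ x P A R w∈
    with α , α∈ , w∈′ ← find (∈-concatMap⁻ (λ α → map (λ β → α ++ x ∷ β) (P R)) {xs = P A} w∈)
    with β , β∈ , refl ← ∈-map⁻ _ w∈′
    = α , β , α∈ , β∈ , refl

  ∈-joinAt⁺ : ∀ x P A R {α β} → α ∈ P A → β ∈ P R → α ++ x ∷ β ∈ joinAt x P (A , R)
  ∈-joinAt⁺ x P A R α∈ β∈ =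
    ∈-concatMap⁺ (λ α → map (λ β → α ++ x ∷ β) (P R)) (lose α∈ (∈-map⁺ _ β∈))

  -- A permutation of x ∷ S is α ++ x ∷ β for a bipartition (A, R) of S and
  -- permutations α of A and β of R; the fuel n ≥ length S only ensures termination.
  arrangements : ℕ → List X → List (List X)
  arrangements _       []      = [] ∷ []
  arrangements zero    (_ ∷ _) = []
  arrangements (suc n) (x ∷ S) = concatMap (joinAt x (arrangements n)) (bipartitions S)

  permutationsOf : List X → List (List X)
  permutationsOf S = arrangements (length S) S

  arrangements-sound : ∀ n S {w} → w ∈ arrangements n S → w ↭ S
  arrangements-sound _       []      (here refl) = ↭-refl
  arrangements-sound (suc n) (x ∷ S) w∈
    with (A , R) , q∈ , w∈′ ← find (∈-concatMap⁻ (joinAt x (arrangements n)) {xs = bipartitions S} w∈)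
    with α , β , α∈ , β∈ , refl ← ∈-joinAt⁻ x (arrangements n) A R w∈′
    = ↭-trans (↭.shift x α β)
        (↭-prep x (↭-trans (↭.++⁺ (arrangements-sound n A α∈) (arrangements-sound n R β∈))
                           (bipartition-↭ S q∈)))

  arrangements-complete : ∀ n S {w} → length S ≤ n → w ↭ S → w ∈ arrangements n S
  arrangements-complete n       []      _           w↭[] with refl ← ↭.↭-empty-inv w↭[] = here refl
  arrangements-complete (suc n) (x ∷ S) (s≤s |S|≤n) w↭
    with α , β , refl ← ∈-∃++ (↭.∈-resp-↭ (↭-sym w↭) (here refl))
    with A , R , q∈ , α↭A , β↭R ← bipartitions-complete S (↭.drop-mid α [] w↭)
    with |A|≤n , |R|≤n ← bipartition-length-≤ S |S|≤n q∈
    = ∈-concatMap⁺ (joinAt x (arrangements n))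
        (lose q∈ (∈-joinAt⁺ x (arrangements n) A R (arrangements-complete n A |A|≤n α↭A)
                                                    (arrangements-complete n R |R|≤n β↭R)))

  arrangements-unique : ∀ n {S} → Unique S → Unique (arrangements n S)
  arrangements-unique _       {[]}    _          = [] ∷ []
  arrangements-unique zero    {_ ∷ _} _          = []
  arrangements-unique (suc n) {x ∷ S} (x∉S ∷ uS) =
    Unique-concatMap⁺ (bipartitions-unique uS) joinAt-unique same-bipartition
    where
    x∉ : ∀ {A R α} → (A , R) ∈ bipartitions S → α ∈ arrangements n A → x ∉ α
    x∉ q∈ α∈ x∈α =
      All.lookup x∉S (∈-bipartition₁ S q∈ (↭.∈-resp-↭ (arrangements-sound n _ α∈) x∈α)) refl

    joinAt-unique : ∀ {q} → q ∈ bipartitions S → Unique (joinAt x (arrangements n) q)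
    joinAt-unique {A , R} q∈ =
      Unique-concatMap⁺ (arrangements-unique n (proj₁ (bipartition-Unique S uS q∈)))
        (λ {α} _ → Unique.map⁺ (List.∷-injectiveʳ ∘ List.++-cancelˡ α _ _)
                               (arrangements-unique n (proj₂ (bipartition-Unique S uS q∈))))
        same-prefix
      where
      same-prefix : ∀ {α α′ w} → α ∈ arrangements n A → α′ ∈ arrangements n A →
                    w ∈ map (λ β → α ++ x ∷ β) (arrangements n R) →
                    w ∈ map (λ β → α′ ++ x ∷ β) (arrangements n R) → α ≡ α′
      same-prefix {α} {α′} α∈ α′∈ w∈ w∈′ with _ , _ , refl ← ∈-map⁻ _ w∈ | _ , _ , eq ← ∈-map⁻ _ w∈′ =
        proj₁ (∉-++-∷-injective α α′ (x∉ q∈ α∈) (x∉ q∈ α′∈) eq)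

    same-bipartition : ∀ {q q′ w} → q ∈ bipartitions S → q′ ∈ bipartitions S →
                       w ∈ joinAt x (arrangements n) q → w ∈ joinAt x (arrangements n) q′ → q ≡ q′
    same-bipartition {A , R} {A′ , R′} q∈ q′∈ w∈ w∈′
      with α , _ , α∈ , _ , refl ← ∈-joinAt⁻ x (arrangements n) A R w∈
         | α′ , _ , α′∈ , _ , eq ← ∈-joinAt⁻ x (arrangements n) A′ R′ w∈′
      with refl , refl ← ∉-++-∷-injective α α′ (x∉ q∈ α∈) (x∉ q′∈ α′∈) eq
      = ∈-bipartitions-injective uS q∈ q′∈
          (↭-trans (↭-sym (arrangements-sound n A α∈)) (arrangements-sound n A′ α′∈))

  permutationsOf-sound : ∀ {S w} → w ∈ permutationsOf S → w ↭ S
  permutationsOf-sound {S} = arrangements-sound (length S) S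

  permutationsOf-complete : ∀ {S w} → w ↭ S → w ∈ permutationsOf S
  permutationsOf-complete {S} = arrangements-complete (length S) S ≤-refl

  permutationsOf-unique : ∀ {S} → Unique S → Unique (permutationsOf S)
  permutationsOf-unique {S} = arrangements-unique (length S)

  ∑-arrangements : ∀ n {S} → Unique S → length S ≤ n → ∀ F → ∑ (arrangements n S) F ≡ ∑ (permutationsOf S) F
  ∑-arrangements n {S} uS |S|≤n = ∑-unique-cong (arrangements-unique n uS) (permutationsOf-unique uS)
    (mk⇔ (permutationsOf-complete ∘ arrangements-sound n S) (arrangements-complete n S |S|≤n ∘ permutationsOf-sound))

  ∑-permutationsOf-↭ : ∀ {S S′} → Unique S → S ↭ S′ → ∀ F → ∑ (permutationsOf S) F ≡ ∑ (permutationsOf S′) F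
  ∑-permutationsOf-↭ uS S↭S′ =
    ∑-unique-cong (permutationsOf-unique uS) (permutationsOf-unique (Unique-resp-↭ S↭S′ uS))
    (mk⇔ (λ w∈ → permutationsOf-complete (↭-trans (permutationsOf-sound w∈) S↭S′))
         (λ w∈ → permutationsOf-complete (↭-trans (permutationsOf-sound w∈) (↭-sym S↭S′))))

  ∑-permutationsOf-∷ : ∀ {x S} → Unique (x ∷ S) → ∀ F →
    ∑ (permutationsOf (x ∷ S)) F ≡
    ∑ (bipartitions S) λ (A , R) → ∑ (permutationsOf A) λ α → ∑ (permutationsOf R) λ β → F (α ++ x ∷ β)
  ∑-permutationsOf-∷ {x} {S} (_ ∷ uS) F =
    trans (∑-concatMap (joinAt x (arrangements n)) (bipartitions S) F) (∑-cong (bipartitions S) split)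
    where
    n = length S
    split : ∀ {q} → q ∈ bipartitions S →
            ∑ (joinAt x (arrangements n) q) F ≡
            ∑ (permutationsOf (proj₁ q)) λ α → ∑ (permutationsOf (proj₂ q)) λ β → F (α ++ x ∷ β)
    split {A , R} q∈ = begin
      ∑ (joinAt x (arrangements n) (A , R)) F
        ≡⟨ ∑-concatMap _ (arrangements n A) F ⟩
      ∑ (arrangements n A) (λ α → ∑ (map (λ β → α ++ x ∷ β) (arrangements n R)) F)
        ≡⟨ ∑-cong (arrangements n A) (λ _ →
             trans (∑-map _ (arrangements n R) F) (∑-arrangements n uR |R|≤n _)) ⟩
      ∑ (arrangements n A) (λ α → ∑ (permutationsOf R) λ β → F (α ++ x ∷ β))
        ≡⟨ ∑-arrangements n uA |A|≤n _ ⟩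
      ∑ (permutationsOf A) (λ α → ∑ (permutationsOf R) λ β → F (α ++ x ∷ β)) ∎
      where
      uA = proj₁ (bipartition-Unique S uS q∈)
      uR = proj₂ (bipartition-Unique S uS q∈)
      |A|≤n = proj₁ (bipartition-length-≤ S ≤-refl q∈)
      |R|≤n = proj₂ (bipartition-length-≤ S ≤-refl q∈)

  permCount : (List X → Bool) → List X → ℕ
  permCount P S = ∑ (permutationsOf S) λ w → ⟦ P w ⟧

  permCount-cong : ∀ {P Q} S → (∀ {w} → w ↭ S → P w ≡ Q w) → permCount P S ≡ permCount Q S
  permCount-cong S P≗Q = ∑-cong (permutationsOf S) (cong ⟦_⟧ ∘ P≗Q ∘ permutationsOf-sound)

  permCount-∷ : ∀ {x S} → Unique (x ∷ S) → (P Pˡ Pʳ : List X → Bool) (c : List X × List X → Bool) →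
    (∀ {A R α β} → (A , R) ∈ bipartitions S → α ↭ A → β ↭ R → P (α ++ x ∷ β) ≡ c (A , R) ∧ (Pˡ α ∧ Pʳ β)) →
    permCount P (x ∷ S) ≡ ∑ (bipartitions S) λ (A , R) → ⟦ c (A , R) ⟧ * (permCount Pˡ A * permCount Pʳ R)
  permCount-∷ {x} {S} u P Pˡ Pʳ c P-split = trans (∑-permutationsOf-∷ u _) (∑-cong (bipartitions S) factor)
    where
    factor : ∀ {q} → q ∈ bipartitions S →
      ∑ (permutationsOf (proj₁ q)) (λ α → ∑ (permutationsOf (proj₂ q)) λ β → ⟦ P (α ++ x ∷ β) ⟧) ≡
      ⟦ c q ⟧ * (permCount Pˡ (proj₁ q) * permCount Pʳ (proj₂ q))
    factor {A , R} q∈ = begin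
      ∑ (permutationsOf A) (λ α → ∑ (permutationsOf R) λ β → ⟦ P (α ++ x ∷ β) ⟧)
        ≡⟨ ∑-cong (permutationsOf A) (λ {α} α∈ → ∑-cong (permutationsOf R) (λ {β} β∈ →
             trans (cong ⟦_⟧ (P-split q∈ (permutationsOf-sound α∈) (permutationsOf-sound β∈)))
                   (trans (⟦∧⟧ (c (A , R)) _) (cong (⟦ c (A , R) ⟧ *_) (⟦∧⟧ (Pˡ α) (Pʳ β)))))) ⟩
      ∑ (permutationsOf A) (λ α → ∑ (permutationsOf R) λ β → ⟦ c (A , R) ⟧ * (⟦ Pˡ α ⟧ * ⟦ Pʳ β ⟧))
        ≡⟨ ∑-cong (permutationsOf A) (λ {α} _ →
             trans (sym (∑-*ˡ ⟦ c (A , R) ⟧ (permutationsOf R) _))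
                   (cong (⟦ c (A , R) ⟧ *_) (sym (∑-*ˡ ⟦ Pˡ α ⟧ (permutationsOf R) _)))) ⟩
      ∑ (permutationsOf A) (λ α → ⟦ c (A , R) ⟧ * (⟦ Pˡ α ⟧ * permCount Pʳ R))
        ≡⟨ ∑-*ˡ ⟦ c (A , R) ⟧ (permutationsOf A) _ ⟨
      ⟦ c (A , R) ⟧ * ∑ (permutationsOf A) (λ α → ⟦ Pˡ α ⟧ * permCount Pʳ R)
        ≡⟨ cong (⟦ c (A , R) ⟧ *_) (∑-*ʳ (permCount Pʳ R) (permutationsOf A) _) ⟨
      ⟦ c (A , R) ⟧ * (permCount Pˡ A * permCount Pʳ R) ∎

<ᵇ-true : ∀ {m n} → m < n → (m <ᵇ n) ≡ true
<ᵇ-true = Equivalence.to T-≡ ∘ <⇒<ᵇ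

<ᵇ-false : ∀ {m n} → n ≤ m → (m <ᵇ n) ≡ false
<ᵇ-false {m} {n} n≤m = ¬-not (λ m<ᵇn → ≤⇒≯ n≤m (<ᵇ⇒< m n (Equivalence.from T-≡ m<ᵇn)))

≡ᵇ-refl : ∀ m → (m ≡ᵇ m) ≡ true
≡ᵇ-refl m = Equivalence.to T-≡ (≡⇒≡ᵇ m m refl)

≡ᵇ-false : ∀ {m n} → m ≢ n → (m ≡ᵇ n) ≡ false
≡ᵇ-false {m} {n} m≢n = ¬-not (m≢n ∘ ≡ᵇ⇒≡ m n ∘ Equivalence.from T-≡)

elemᵇ-∈ : ∀ {x l} → x ∈ l → elemᵇ x l ≡ true
elemᵇ-∈ {x} (here refl) rewrite ≡ᵇ-refl x = refl
elemᵇ-∈ {x} {y ∷ _} (there x∈l) rewrite elemᵇ-∈ x∈l = ∨-zeroʳ (x ≡ᵇ y)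

elemᵇ-∉ : ∀ {x l} → x ∉ l → elemᵇ x l ≡ false
elemᵇ-∉ {l = []}    _   = refl
elemᵇ-∉ {l = _ ∷ _} x∉l rewrite ≡ᵇ-false (x∉l ∘ here) = elemᵇ-∉ (x∉l ∘ there)

elemᵇ-↭ : ∀ x {β R} → β ↭ R → elemᵇ x β ≡ elemᵇ x R
elemᵇ-↭ x {β} {R} β↭R with x ∈? R
... | yes x∈R = trans (elemᵇ-∈ (↭.∈-resp-↭ (↭-sym β↭R) x∈R)) (sym (elemᵇ-∈ x∈R))
... | no  x∉R = trans (elemᵇ-∉ (x∉R ∘ ↭.∈-resp-↭ β↭R)) (sym (elemᵇ-∉ x∉R))

oddᵇ : ℕ → Bool
oddᵇ n = not (evenᵇ n)

evenᵇ-suc : ∀ n → evenᵇ (suc n) ≡ oddᵇ n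
evenᵇ-suc zero          = refl
evenᵇ-suc (suc zero)    = refl
evenᵇ-suc (suc (suc n)) = evenᵇ-suc n

oddᵇ-+ : ∀ b c → oddᵇ b ≡ true → oddᵇ (b + c) ≡ evenᵇ c
oddᵇ-+ (suc zero)    c _     = trans (cong not (evenᵇ-suc c)) (not-involutive (evenᵇ c))
oddᵇ-+ (suc (suc b)) c odd-b = oddᵇ-+ b c odd-b

oddᵇ⇒nonzero : ∀ {b} → oddᵇ b ≡ true → 0 < b
oddᵇ⇒nonzero {suc _} _ = s≤s z≤n

-- The Bool is the value on the empty word.  It makes the first letter of
-- α ++ m ∷ β depend on α and m only (firstSatisfies-++-∷), and dually.
firstSatisfies : (ℕ → Bool) → Bool → List ℕ → Bool
firstSatisfies p z []      = z
firstSatisfies p z (x ∷ _) = p x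

lastSatisfies : (ℕ → Bool) → Bool → List ℕ → Bool
lastSatisfies p z []           = z
lastSatisfies p z (x ∷ [])     = p x
lastSatisfies p z (_ ∷ y ∷ ys) = lastSatisfies p z (y ∷ ys)

firstIs≡firstSatisfies : ∀ k w → firstIs k w ≡ firstSatisfies (_≡ᵇ k) false w
firstIs≡firstSatisfies k []      = refl
firstIs≡firstSatisfies k (_ ∷ _) = refl

lastIs≡lastSatisfies : ∀ k w → lastIs k w ≡ lastSatisfies (_≡ᵇ k) false w
lastIs≡lastSatisfies k []           = refl
lastIs≡lastSatisfies k (_ ∷ [])     = refl
lastIs≡lastSatisfies k (_ ∷ y ∷ ys) = lastIs≡lastSatisfies k (y ∷ ys)

firstSatisfies-true : ∀ w → firstSatisfies (const true) true w ≡ true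
firstSatisfies-true []      = refl
firstSatisfies-true (_ ∷ _) = refl

lastSatisfies-true : ∀ w → lastSatisfies (const true) true w ≡ true
lastSatisfies-true []           = refl
lastSatisfies-true (_ ∷ [])     = refl
lastSatisfies-true (_ ∷ y ∷ ys) = lastSatisfies-true (y ∷ ys)

firstSatisfies-++-∷ : ∀ p z α m β → firstSatisfies p z (α ++ m ∷ β) ≡ firstSatisfies p (p m) α
firstSatisfies-++-∷ p z []      m β = refl
firstSatisfies-++-∷ p z (_ ∷ _) m β = refl

lastSatisfies-∷ : ∀ p z z′ x ys → lastSatisfies p z (x ∷ ys) ≡ lastSatisfies p z′ (x ∷ ys)
lastSatisfies-∷ p z z′ x []       = refl
lastSatisfies-∷ p z z′ x (y ∷ ys) = lastSatisfies-∷ p z z′ y ys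

lastSatisfies-++-∷ : ∀ p z α m β → lastSatisfies p z (α ++ m ∷ β) ≡ lastSatisfies p (p m) β
lastSatisfies-++-∷ p z []          m []       = refl
lastSatisfies-++-∷ p z []          m (y ∷ ys) = lastSatisfies-∷ p z (p m) y ys
lastSatisfies-++-∷ p z (_ ∷ [])    m β        = lastSatisfies-++-∷ p z [] m β
lastSatisfies-++-∷ p z (_ ∷ y ∷ α) m β        = lastSatisfies-++-∷ p z (y ∷ α) m β

-- In a word that alternates starting with an ascent iff b, whether the step
-- leaving the letter right after α is an ascent.
ascentAfter : Bool → List ℕ → Bool
ascentAfter b []      = b
ascentAfter b (_ ∷ α) = ascentAfter (not b) α

ascentAfter-parity : ∀ b α → ascentAfter b α ≡ (if evenᵇ (length α) then b else not b)
ascentAfter-parity b []          = refl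
ascentAfter-parity b (_ ∷ [])    = refl
ascentAfter-parity b (_ ∷ _ ∷ α) = trans (cong (λ c → ascentAfter c α) (not-involutive b)) (ascentAfter-parity b α)

∧-if-false : ∀ c d x y → c ∧ (if d then x ∧ y else false) ≡ (if d then (c ∧ x) ∧ y else false)
∧-if-false c true  x y = sym (∧-assoc c x y)
∧-if-false c false x y = ∧-zeroʳ c

∧-if-false′ : ∀ c d x y → c ∧ (if d then false else x ∧ y) ≡ (if d then false else (c ∧ x) ∧ y)
∧-if-false′ c true  x y = ∧-zeroʳ c
∧-if-false′ c false x y = sym (∧-assoc c x y)

alt-++-min : ∀ b {m} α β → All (m <_) α → All (m <_) β →
  alt b (α ++ m ∷ β) ≡ (if ascentAfter b α then alt b α ∧ alt false β else null α ∧ null β)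
alt-++-min true  []          []      _         _         = refl
alt-++-min false []          []      _         _         = refl
alt-++-min true  []          (_ ∷ _) _         (m<y ∷ _) rewrite <ᵇ-true m<y = refl
alt-++-min false []          (y ∷ _) _         (m<y ∷ _) rewrite <ᵇ-false {y} (<⇒≤ m<y) = refl
alt-++-min true  (x ∷ [])    β       (m<x ∷ _) _         rewrite <ᵇ-false {x} (<⇒≤ m<x) = refl
alt-++-min false (x ∷ [])    β       (m<x ∷ _) m<β       rewrite <ᵇ-true m<x = alt-++-min true [] β [] m<β
alt-++-min true  (x ∷ y ∷ α) β       (_ ∷ m<α) m<β =
  trans (cong ((x <ᵇ y) ∧_) (alt-++-min false (y ∷ α) β m<α m<β))
        (∧-if-false (x <ᵇ y) (ascentAfter false (y ∷ α)) _ _)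
alt-++-min false (x ∷ y ∷ α) β       (_ ∷ m<α) m<β =
  trans (cong ((y <ᵇ x) ∧_) (alt-++-min true (y ∷ α) β m<α m<β))
        (∧-if-false (y <ᵇ x) (ascentAfter true (y ∷ α)) _ _)

alt-++-max : ∀ b {M} α β → All (_< M) α → All (_< M) β →
  alt b (α ++ M ∷ β) ≡ (if ascentAfter b α then null α ∧ null β else alt b α ∧ alt true β)
alt-++-max true  []          []      _         _         = refl
alt-++-max false []          []      _         _         = refl
alt-++-max true  []          (y ∷ _) _         (y<M ∷ _) rewrite <ᵇ-false {_} {y} (<⇒≤ y<M) = refl
alt-++-max false []          (_ ∷ _) _         (y<M ∷ _) rewrite <ᵇ-true y<M = refl
alt-++-max true  (x ∷ [])    β       (x<M ∷ _) β<M       rewrite <ᵇ-true x<M = alt-++-max false [] β [] β<M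
alt-++-max false (x ∷ [])    β       (x<M ∷ _) _         rewrite <ᵇ-false {_} {x} (<⇒≤ x<M) = refl
alt-++-max true  (x ∷ y ∷ α) β       (_ ∷ α<M) β<M =
  trans (cong ((x <ᵇ y) ∧_) (alt-++-max false (y ∷ α) β α<M β<M))
        (∧-if-false′ (x <ᵇ y) (ascentAfter false (y ∷ α)) _ _)
alt-++-max false (x ∷ y ∷ α) β       (_ ∷ α<M) β<M =
  trans (cong ((y <ᵇ x) ∧_) (alt-++-max true (y ∷ α) β α<M β<M))
        (∧-if-false′ (y <ᵇ x) (ascentAfter true (y ∷ α)) _ _)

upDown-++-min : ∀ {m} α β → All (m <_) α → All (m <_) β →
  upDownᵇ (α ++ m ∷ β) ≡ evenᵇ (length α) ∧ (upDownᵇ α ∧ alt false β)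
upDown-++-min []        β m<α m<β = alt-++-min true [] β m<α m<β
upDown-++-min α@(_ ∷ _) β m<α m<β
  rewrite alt-++-min true α β m<α m<β | ascentAfter-parity true α with evenᵇ (length α)
... | true  = refl
... | false = refl

downUp-++-max : ∀ {M} α β → All (_< M) α → All (_< M) β →
  alt false (α ++ M ∷ β) ≡ evenᵇ (length α) ∧ (alt false α ∧ upDownᵇ β)
downUp-++-max []        β α<M β<M = alt-++-max false [] β α<M β<M
downUp-++-max α@(_ ∷ _) β α<M β<M
  rewrite alt-++-max false α β α<M β<M | ascentAfter-parity false α with evenᵇ (length α)
... | true  = refl
... | false = refl

upDown-++-max : ∀ {M} α β → All (_< M) α → All (_< M) β → 0 < length α + length β →
  upDownᵇ (α ++ M ∷ β) ≡ oddᵇ (length α) ∧ (upDownᵇ α ∧ upDownᵇ β)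
upDown-++-max []        (_ ∷ _) α<M β<M _ = alt-++-max true [] _ α<M β<M
upDown-++-max α@(_ ∷ _) β       α<M β<M _
  rewrite alt-++-max true α β α<M β<M | ascentAfter-parity true α with evenᵇ (length α)
... | true  = refl
... | false = refl

rhoLen-++-∷ : ∀ {x m} ys zs → m < x → rhoLen x (ys ++ m ∷ zs) ≡ rhoLen x ys
rhoLen-++-∷ {x} {m} []       zs m<x rewrite <ᵇ-false {x} {m} (<⇒≤ m<x) = refl
rhoLen-++-∷ {x}     (y ∷ ys) zs m<x with x <ᵇ y
... | true  = cong suc (rhoLen-++-∷ ys zs m<x)
... | false = refl

rhoLen-all : ∀ {m} β → All (m <_) β → rhoLen m β ≡ length β
rhoLen-all []      []          = refl
rhoLen-all (y ∷ β) (m<y ∷ m<β) rewrite <ᵇ-true m<y = cong suc (rhoLen-all β m<β)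

jacobiᵇ-++-min : ∀ {m} α β → All (m <_) α → All (m <_) β →
  jacobiᵇ (α ++ m ∷ β) ≡ jacobiᵇ α ∧ (evenᵇ (length β) ∧ jacobiᵇ β)
jacobiᵇ-++-min []      β _           m<β rewrite rhoLen-all β m<β = refl
jacobiᵇ-++-min (x ∷ α) β (m<x ∷ m<α) m<β rewrite rhoLen-++-∷ α β m<x | jacobiᵇ-++-min α β m<α m<β =
  sym (∧-assoc (evenᵇ (rhoLen x α)) (jacobiᵇ α) _)

minimum : List ℕ → ℕ
minimum []       = 0
minimum (x ∷ xs) = minimumOf x xs

minimumOf-∈ : ∀ x xs → minimumOf x xs ∈ x ∷ xs
minimumOf-∈ x xs = List.foldr-preservesᵇ ⊓-∈ (here refl) (All.tabulate there)
  where
  ⊓-∈ : ∀ {a b} → a ∈ x ∷ xs → b ∈ x ∷ xs → a ⊓ b ∈ x ∷ xs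
  ⊓-∈ {a} {b} a∈ b∈ =
    [ (λ eq → subst (_∈ x ∷ xs) (sym eq) a∈) , (λ eq → subst (_∈ x ∷ xs) (sym eq) b∈) ]′ (⊓-sel a b)

minimum-least : ∀ {m} w → m ∈ w → All (m ≤_) w → minimum w ≡ m
minimum-least {m} (x ∷ xs) m∈ (m≤x ∷ m≤xs) =
  ≤-antisym (List.foldr-preservesᵒ (λ a b → [ ≤-trans (m⊓n≤m a b) , ≤-trans (m⊓n≤n a b) ]′) x xs (below m∈))
            (List.foldr-preservesᵇ ⊓-glb m≤x m≤xs)
  where
  below : m ∈ x ∷ xs → x ≤ m ⊎ Any.Any (_≤ m) xs
  below (here refl)  = inj₁ ≤-refl
  below (there m∈xs) = inj₂ (Any.map (≤-reflexive ∘ sym) m∈xs)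

maximumOf-greatest : ∀ {M} x xs → M ∈ x ∷ xs → All (_≤ M) (x ∷ xs) → maximumOf x xs ≡ M
maximumOf-greatest {M} x xs M∈ (x≤M ∷ xs≤M) =
  ≤-antisym (List.foldr-preservesᵇ ⊔-lub x≤M xs≤M)
            (List.foldr-preservesᵒ (λ a b → [ (λ M≤a → ≤-trans M≤a (m≤m⊔n a b))
                                            , (λ M≤b → ≤-trans M≤b (m≤n⊔m a b)) ]′)
                                   x xs (above M∈))
  where
  above : M ∈ x ∷ xs → M ≤ x ⊎ Any.Any (M ≤_) xs
  above (here refl)  = inj₁ ≤-refl
  above (there M∈xs) = inj₂ (Any.map ≤-reflexive M∈xs)

splitOn-length : ∀ {y} l → y ∈ l →
  suc (length (Split.before (splitOn y l)) + length (Split.after (splitOn y l))) ≡ length l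
splitOn-length {y} (x ∷ xs) y∈ with x ≡ᵇ y in x≡ᵇy
... | true = refl
... | false with y∈
...   | here refl with () ← trans (sym (≡ᵇ-refl y)) x≡ᵇy
...   | there y∈xs = cong suc (splitOn-length xs y∈xs)

splitOn-minimumOf-length : ∀ x xs → let s = splitOn (minimumOf x xs) (x ∷ xs) in
  length (Split.before s) + length (Split.after s) ≡ length xs
splitOn-minimumOf-length x xs = suc-injective (splitOn-length (x ∷ xs) (minimumOf-∈ x xs))

splitOn-++-∷ : ∀ {m} α β → All (_≢ m) α → splitOn m (α ++ m ∷ β) ≡ (α , β)
splitOn-++-∷ {m} []      β []          rewrite ≡ᵇ-refl m = refl
splitOn-++-∷     (x ∷ α) β (x≢m ∷ α≢m) rewrite ≡ᵇ-false x≢m | splitOn-++-∷ α β α≢m = refl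

andreF-fuel : ∀ f g w → length w ≤ f → length w ≤ g → andreF f w ≡ andreF g w
andreF-fuel f       g       []       _            _            = refl
andreF-fuel (suc f) (suc g) (x ∷ xs) (s≤s |xs|≤f) (s≤s |xs|≤g) =
  cong₂ (λ a b → a ∧ b ∧ largestInβ before after)
    (andreF-fuel f g before (≤-trans |before|≤ |xs|≤f) (≤-trans |before|≤ |xs|≤g))
    (andreF-fuel f g after  (≤-trans |after|≤  |xs|≤f) (≤-trans |after|≤  |xs|≤g))
  where
  before = Split.before (splitOn (minimumOf x xs) (x ∷ xs))
  after  = Split.after (splitOn (minimumOf x xs) (x ∷ xs))
  |before|≤ = m+n≤o⇒m≤o (length before) (≤-reflexive (splitOn-minimumOf-length x xs))
  |after|≤  = m+n≤o⇒n≤o (length before) (≤-reflexive (splitOn-minimumOf-length x xs))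

andreᵇ-∷ : ∀ x xs {α β} → splitOn (minimumOf x xs) (x ∷ xs) ≡ (α , β) →
  andreᵇ (x ∷ xs) ≡ andreᵇ α ∧ andreᵇ β ∧ largestInβ α β
andreᵇ-∷ x xs {α} {β} split≡ =
  trans (cong (λ s → andreF (length xs) (Split.before s) ∧ andreF (length xs) (Split.after s)
                     ∧ largestInβ (Split.before s) (Split.after s)) split≡)
        (cong₂ (λ a b → a ∧ b ∧ largestInβ α β)
          (andreF-fuel (length xs) (length α) α |α|≤ ≤-refl) (andreF-fuel (length xs) (length β) β |β|≤ ≤-refl))
  where
  |α|+|β|≡ : length α + length β ≡ length xs
  |α|+|β|≡ = subst (λ s → length (Split.before s) + length (Split.after s) ≡ length xs) split≡
                   (splitOn-minimumOf-length x xs)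
  |α|≤ = m+n≤o⇒m≤o (length α) (≤-reflexive |α|+|β|≡)
  |β|≤ = m+n≤o⇒n≤o (length α) (≤-reflexive |α|+|β|≡)

splitOn-at-minimum : ∀ {m} α β → All (m <_) α → All (m <_) β →
  splitOn (minimum (α ++ m ∷ β)) (α ++ m ∷ β) ≡ (α , β)
splitOn-at-minimum {m} α β m<α m<β =
  trans (cong (λ y → splitOn y (α ++ m ∷ β))
          (minimum-least (α ++ m ∷ β) (∈-++⁺ʳ α (here refl))
                         (All.++⁺ (All.map <⇒≤ m<α) (≤-refl ∷ All.map <⇒≤ m<β))))
        (splitOn-++-∷ α β (All.map (λ m<x x≡m → <-irrefl (sym x≡m) m<x) m<α))

andreᵇ-++-min : ∀ {m} α β → All (m <_) α → All (m <_) β →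
  andreᵇ (α ++ m ∷ β) ≡ andreᵇ α ∧ andreᵇ β ∧ largestInβ α β
andreᵇ-++-min     []      β m<α m<β = andreᵇ-∷ _ β (splitOn-at-minimum [] β m<α m<β)
andreᵇ-++-min {m} (x ∷ α) β m<α m<β = andreᵇ-∷ x (α ++ m ∷ β) (splitOn-at-minimum (x ∷ α) β m<α m<β)

maximumOf-↭ : ∀ {M Q} x xs → x ∷ xs ↭ M ∷ Q → All (_< M) Q → maximumOf x xs ≡ M
maximumOf-↭ x xs x∷xs↭ Q<M =
  maximumOf-greatest x xs (↭.∈-resp-↭ (↭-sym x∷xs↭) (here refl))
                          (↭.All-resp-↭ (↭-sym x∷xs↭) (≤-refl ∷ All.map <⇒≤ Q<M))

largestInβ-max : ∀ {M Q} α β → α ++ β ↭ M ∷ Q → All (_< M) Q → largestInβ α β ≡ elemᵇ M β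
largestInβ-max (a ∷ α) β       αβ↭ Q<M = cong (λ t → elemᵇ t β) (maximumOf-↭ a (α ++ β) αβ↭ Q<M)
largestInβ-max []      (b ∷ β) αβ↭ Q<M = cong (λ t → elemᵇ t (b ∷ β)) (maximumOf-↭ b β αβ↭ Q<M)
largestInβ-max []      []      αβ↭ _   with () ← ↭.↭-length αβ↭

oneTo-unique : ∀ n → Unique (oneTo n)
oneTo-unique n = Unique.applyUpTo⁺₁ suc n (λ i<j _ → <⇒≢ i<j ∘ suc-injective)

words-unique : ∀ n l → Unique (words n l)
words-unique n zero    = [] ∷ []
words-unique n (suc l) =
  Unique-concatMap⁺ (oneTo-unique n) (λ _ → Unique.map⁺ List.∷-injectiveʳ (words-unique n l)) same-head
  where
  same-head : ∀ {a b w} → a ∈ oneTo n → b ∈ oneTo n →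
              w ∈ map (a ∷_) (words n l) → w ∈ map (b ∷_) (words n l) → a ≡ b
  same-head _ _ w∈ w∈′ with _ , _ , refl ← ∈-map⁻ _ w∈ | _ , _ , eq ← ∈-map⁻ _ w∈′ = List.∷-injectiveˡ eq

∈-words⁻ : ∀ n l {w} → w ∈ words n l → length w ≡ l × All (_∈ oneTo n) w
∈-words⁻ n zero    (here refl) = refl , []
∈-words⁻ n (suc l) w∈
  with a , a∈ , w∈′ ← find (∈-concatMap⁻ (λ a → map (a ∷_) (words n l)) {xs = oneTo n} w∈)
  with w′ , w′∈ , refl ← ∈-map⁻ _ w∈′
  with |w′|≡l , w′⊆ ← ∈-words⁻ n l w′∈
  = cong suc |w′|≡l , a∈ ∷ w′⊆

∈-words⁺ : ∀ n {w} → All (_∈ oneTo n) w → w ∈ words n (length w)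
∈-words⁺ n []                = here refl
∈-words⁺ n {_ ∷ w} (a∈ ∷ w⊆) =
  ∈-concatMap⁺ (λ a → map (a ∷_) (words n (length w))) (lose a∈ (∈-map⁺ _ (∈-words⁺ n w⊆)))

distinctᵇ⇒Unique : ∀ w → T (distinctᵇ w) → Unique w
distinctᵇ⇒Unique []      _ = []
distinctᵇ⇒Unique (x ∷ w) t with elemᵇ x w in x∈ᵇw
... | false = All.tabulate (λ y∈w x≡y → x∉w (subst (_∈ w) (sym x≡y) y∈w)) ∷ distinctᵇ⇒Unique w t
  where
  x∉w : x ∉ w
  x∉w x∈w with () ← trans (sym (elemᵇ-∈ x∈w)) x∈ᵇw

Unique⇒distinctᵇ : ∀ {w} → Unique w → T (distinctᵇ w)
Unique⇒distinctᵇ []                = _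
Unique⇒distinctᵇ {x ∷ w} (x≢w ∷ u) rewrite elemᵇ-∉ (λ x∈w → All.lookup x≢w x∈w refl) = Unique⇒distinctᵇ u

perms-sound : ∀ n {w} → w ∈ perms n → w ↭ oneTo n
perms-sound n w∈
  with w∈words , distinct ← ∈-filter⁻ (T? ∘ distinctᵇ) {xs = words n n} w∈
  with |w|≡n , w⊆ ← ∈-words⁻ n n w∈words
  = ⊆-length⇒↭ (distinctᵇ⇒Unique _ distinct) w⊆ (≤-reflexive (trans (List.length-applyUpTo suc n) (sym |w|≡n)))

perms-complete : ∀ n {w} → w ↭ oneTo n → w ∈ perms n
perms-complete n {w} w↭ =
  ∈-filter⁺ (T? ∘ distinctᵇ)
    (subst (λ l → w ∈ words n l) (trans (↭.↭-length w↭) (List.length-applyUpTo suc n))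
      (∈-words⁺ n (All.tabulate (↭.∈-resp-↭ w↭))))
    (Unique⇒distinctᵇ (Unique-resp-↭ (↭-sym w↭) (oneTo-unique n)))

length-filter : ∀ (P : List ℕ → Bool) ws → length (filter (T? ∘ P) ws) ≡ ∑ ws (λ w → ⟦ P w ⟧)
length-filter P []       = refl
length-filter P (w ∷ ws) with P w
... | true  = cong suc (length-filter P ws)
... | false = length-filter P ws

countPerms≡permCount : ∀ n P → countPerms n P ≡ permCount P (oneTo n)
countPerms≡permCount n P =
  trans (length-filter P (perms n))
    (∑-unique-cong (Unique.filter⁺ (T? ∘ distinctᵇ) (words-unique n n)) (permutationsOf-unique (oneTo-unique n))
       (mk⇔ (permutationsOf-complete ∘ perms-sound n) (perms-complete n ∘ permutationsOf-sound)) _)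

countPerms-firstIs : ∀ n k (P : List ℕ → Bool) →
  countPerms n (λ π → P π ∧ firstIs k π) ≡ permCount (λ π → P π ∧ firstSatisfies (_≡ᵇ k) false π) (oneTo n)
countPerms-firstIs n k P =
  trans (countPerms≡permCount n _) (permCount-cong (oneTo n) (λ {π} _ → cong (P π ∧_) (firstIs≡firstSatisfies k π)))

countPerms-lastIs : ∀ n k (P : List ℕ → Bool) →
  countPerms n (λ π → P π ∧ lastIs k π) ≡ permCount (λ π → P π ∧ lastSatisfies (_≡ᵇ k) false π) (oneTo n)
countPerms-lastIs n k P =
  trans (countPerms≡permCount n _) (permCount-cong (oneTo n) (λ {π} _ → cong (P π ∧_) (lastIs≡lastSatisfies k π)))

#upDown : (ℕ → Bool) → Bool → List ℕ → ℕ
#upDown p z = permCount (λ w → upDownᵇ w ∧ firstSatisfies p z w)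

#downUp : List ℕ → ℕ
#downUp = permCount (alt false)

#jacobi : (ℕ → Bool) → Bool → List ℕ → ℕ
#jacobi p z = permCount (λ w → jacobiᵇ w ∧ lastSatisfies p z w)

#andre : (ℕ → Bool) → Bool → List ℕ → ℕ
#andre p z = permCount (λ w → andreᵇ w ∧ firstSatisfies p z w)

#upDownTotal #jacobiTotal #andreTotal : List ℕ → ℕ
#upDownTotal = #upDown (const true) true
#jacobiTotal = #jacobi (const true) true
#andreTotal  = #andre (const true) true

open ∨-∧-Solver using (solve; _:*_; _:=_; con)

#upDown-min : ∀ p z {m S} → Unique (m ∷ S) → All (m <_) S →
  #upDown p z (m ∷ S) ≡ ∑ (bipartitions S) λ (A , R) → ⟦ evenᵇ (length A) ⟧ * (#upDown p (p m) A * #downUp R)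
#upDown-min p z {m} {S} u m<S = permCount-∷ u _ _ _ (evenᵇ ∘ length ∘ proj₁) cut
  where
  cut : ∀ {A R α β} → (A , R) ∈ bipartitions S → α ↭ A → β ↭ R →
    upDownᵇ (α ++ m ∷ β) ∧ firstSatisfies p z (α ++ m ∷ β) ≡
    evenᵇ (length A) ∧ ((upDownᵇ α ∧ firstSatisfies p (p m) α) ∧ alt false β)
  cut {A} {R} {α} {β} q∈ α↭A β↭R with m<α , m<β ← bipartition-All-↭ S m<S q∈ α↭A β↭R
    rewrite upDown-++-min α β m<α m<β | firstSatisfies-++-∷ p z α m β | ↭.↭-length α↭A =
    solve 4 (λ e u d h → (e :* (u :* d)) :* h := e :* ((u :* h) :* d)) refl
      (evenᵇ (length A)) (upDownᵇ α) (alt false β) (firstSatisfies p (p m) α)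

#downUp-max : ∀ {M S} → Unique (M ∷ S) → All (_< M) S →
  #downUp (M ∷ S) ≡ ∑ (bipartitions S) λ (A , R) → ⟦ evenᵇ (length A) ⟧ * (#downUp A * #upDownTotal R)
#downUp-max {M} {S} u S<M = permCount-∷ u _ _ _ (evenᵇ ∘ length ∘ proj₁) cut
  where
  cut : ∀ {A R α β} → (A , R) ∈ bipartitions S → α ↭ A → β ↭ R →
    alt false (α ++ M ∷ β) ≡ evenᵇ (length A) ∧ (alt false α ∧ (upDownᵇ β ∧ firstSatisfies (const true) true β))
  cut {α = α} {β} q∈ α↭A β↭R with α<M , β<M ← bipartition-All-↭ S S<M q∈ α↭A β↭R
    rewrite downUp-++-max α β α<M β<M | firstSatisfies-true β | ∧-identityʳ (upDownᵇ β) | ↭.↭-length α↭A = refl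

#upDown-max : ∀ p z {M S} → Unique (M ∷ S) → All (_< M) S → 0 < length S →
  #upDown p z (M ∷ S) ≡ ∑ (bipartitions S) λ (A , R) → ⟦ oddᵇ (length A) ⟧ * (#upDown p (p M) A * #upDownTotal R)
#upDown-max p z {M} {S} u S<M 0<|S| = permCount-∷ u _ _ _ (oddᵇ ∘ length ∘ proj₁) cut
  where
  cut : ∀ {A R α β} → (A , R) ∈ bipartitions S → α ↭ A → β ↭ R →
    upDownᵇ (α ++ M ∷ β) ∧ firstSatisfies p z (α ++ M ∷ β) ≡
    oddᵇ (length A) ∧ ((upDownᵇ α ∧ firstSatisfies p (p M) α) ∧ (upDownᵇ β ∧ firstSatisfies (const true) true β))
  cut {A} {R} {α} {β} q∈ α↭A β↭R with α<M , β<M ← bipartition-All-↭ S S<M q∈ α↭A β↭R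
    rewrite upDown-++-max α β α<M β<M (subst (0 <_) (sym (bipartition-↭-length S q∈ α↭A β↭R)) 0<|S|)
          | firstSatisfies-++-∷ p z α M β | firstSatisfies-true β | ↭.↭-length α↭A =
    solve 4 (λ o u v h → (o :* (u :* v)) :* h := o :* ((u :* h) :* (v :* con true))) refl
      (oddᵇ (length A)) (upDownᵇ α) (upDownᵇ β) (firstSatisfies p (p M) α)

#jacobi-min : ∀ p z {m S} → Unique (m ∷ S) → All (m <_) S →
  #jacobi p z (m ∷ S) ≡ ∑ (bipartitions S) λ (A , R) → ⟦ evenᵇ (length R) ⟧ * (#jacobiTotal A * #jacobi p (p m) R)
#jacobi-min p z {m} {S} u m<S = permCount-∷ u _ _ _ (evenᵇ ∘ length ∘ proj₂) cut
  where
  cut : ∀ {A R α β} → (A , R) ∈ bipartitions S → α ↭ A → β ↭ R →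
    jacobiᵇ (α ++ m ∷ β) ∧ lastSatisfies p z (α ++ m ∷ β) ≡
    evenᵇ (length R) ∧ ((jacobiᵇ α ∧ lastSatisfies (const true) true α) ∧ (jacobiᵇ β ∧ lastSatisfies p (p m) β))
  cut {A} {R} {α} {β} q∈ α↭A β↭R with m<α , m<β ← bipartition-All-↭ S m<S q∈ α↭A β↭R
    rewrite jacobiᵇ-++-min α β m<α m<β | lastSatisfies-++-∷ p z α m β | lastSatisfies-true α | ↭.↭-length β↭R =
    solve 4 (λ a e b l → (a :* (e :* b)) :* l := e :* ((a :* con true) :* (b :* l))) refl
      (jacobiᵇ α) (evenᵇ (length R)) (jacobiᵇ β) (lastSatisfies p (p m) β)

#andre-min : ∀ p z {m M Q} → Unique (m ∷ M ∷ Q) → All (m <_) (M ∷ Q) → All (_< M) Q →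
  #andre p z (m ∷ M ∷ Q) ≡
  ∑ (bipartitions (M ∷ Q)) λ (A , R) → ⟦ elemᵇ M R ⟧ * (#andre p (p m) A * #andreTotal R)
#andre-min p z {m} {M} {Q} u m<MQ Q<M = permCount-∷ u _ _ _ (elemᵇ M ∘ proj₂) cut
  where
  cut : ∀ {A R α β} → (A , R) ∈ bipartitions (M ∷ Q) → α ↭ A → β ↭ R →
    andreᵇ (α ++ m ∷ β) ∧ firstSatisfies p z (α ++ m ∷ β) ≡
    elemᵇ M R ∧ ((andreᵇ α ∧ firstSatisfies p (p m) α) ∧ (andreᵇ β ∧ firstSatisfies (const true) true β))
  cut {A} {R} {α} {β} q∈ α↭A β↭R with m<α , m<β ← bipartition-All-↭ (M ∷ Q) m<MQ q∈ α↭A β↭R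
    rewrite andreᵇ-++-min α β m<α m<β | firstSatisfies-++-∷ p z α m β | firstSatisfies-true β
          | largestInβ-max α β (↭-trans (↭.++⁺ α↭A β↭R) (bipartition-↭ (M ∷ Q) q∈)) Q<M | elemᵇ-↭ M β↭R =
    solve 4 (λ a b l h → (a :* (b :* l)) :* h := l :* ((a :* h) :* (b :* con true))) refl
      (andreᵇ α) (andreᵇ β) (elemᵇ M R) (firstSatisfies p (p m) α)

#andre-singleton : ∀ p z m → #andre p z (m ∷ []) ≡ #upDown p z (m ∷ [])
#andre-singleton p z m = cong (λ b → ⟦ b ∧ p m ⟧ + 0) (andreᵇ-++-min {m} [] [] [] [])

#upDown-nonempty : ∀ p z z′ S → 0 < length S → #upDown p z S ≡ #upDown p z′ S
#upDown-nonempty p z z′ S 0<|S| = permCount-cong S first-letter-exists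
  where
  first-letter-exists : ∀ {w} → w ↭ S → upDownᵇ w ∧ firstSatisfies p z w ≡ upDownᵇ w ∧ firstSatisfies p z′ w
  first-letter-exists {_ ∷ _} _    = refl
  first-letter-exists {[]}    []↭S with () ← subst (0 <_) (sym (↭.↭-length []↭S)) 0<|S|

-- Stated for two sets of the same size: the up-down side is cut at its minimum
-- and the down-up side at its maximum, which leaves different sets of blocks.
#upDownTotal≡#downUp : ∀ {S T} → length S ≡ length T → Unique S → Unique T → #upDownTotal S ≡ #downUp T
#upDownTotal≡#downUp {S} = go (length S) ≤-refl
  where
  go : ∀ n {S T} → length S ≤ n → length S ≡ length T → Unique S → Unique T → #upDownTotal S ≡ #downUp T
  go _       {[]}    {[]}    _           _       _  _  = refl
  go (suc n) {x ∷ S} {y ∷ T} (s≤s |S|≤n) |S|≡|T| uS uT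
    with m , S′ , S↭ , m<S′ ← extract-minimum uS
       | M , T′ , T↭ , T′<M ← extract-maximum uT = begin
    #upDownTotal (x ∷ S)
      ≡⟨ ∑-permutationsOf-↭ uS S↭ _ ⟩
    #upDownTotal (m ∷ S′)
      ≡⟨ #upDown-min (const true) true uS′ m<S′ ⟩
    ∑ (bipartitions S′) (λ (A , R) → ⟦ evenᵇ (length A) ⟧ * (#upDownTotal A * #downUp R))
      ≡⟨ ∑-bipartitions-cong-length S′ T′ |S′|≡|T′| same-length-blocks ⟩
    ∑ (bipartitions T′) (λ (A , R) → ⟦ evenᵇ (length A) ⟧ * (#downUp A * #upDownTotal R))
      ≡⟨ #downUp-max uT′ T′<M ⟨
    #downUp (M ∷ T′)
      ≡⟨ ∑-permutationsOf-↭ uT T↭ _ ⟨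
    #downUp (y ∷ T) ∎
    where
    uS′ = Unique-resp-↭ S↭ uS
    uT′ = Unique-resp-↭ T↭ uT
    |S′|≡|S| = suc-injective (sym (↭.↭-length S↭))
    |S′|≡|T′| = trans |S′|≡|S| (trans (suc-injective |S|≡|T|) (suc-injective (↭.↭-length T↭)))
    same-length-blocks : ∀ {A R A′ R′} → (A , R) ∈ bipartitions S′ → (A′ , R′) ∈ bipartitions T′ →
      length A ≡ length A′ → length R ≡ length R′ →
      ⟦ evenᵇ (length A) ⟧ * (#upDownTotal A * #downUp R) ≡ ⟦ evenᵇ (length A′) ⟧ * (#downUp A′ * #upDownTotal R′)
    same-length-blocks q∈ q′∈ |A|≡ |R|≡
      with |A|≤n , |R|≤n ← bipartition-length-≤ S′ (subst (_≤ n) (sym |S′|≡|S|) |S|≤n) q∈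
         | uA , uR ← bipartition-Unique S′ (tail uS′) q∈
         | uA′ , uR′ ← bipartition-Unique T′ (tail uT′) q′∈
      = cong₂ _*_ (cong (⟦_⟧ ∘ evenᵇ) |A|≡)
          (cong₂ _*_ (go n |A|≤n |A|≡ uA uA′) (sym (go n (subst (_≤ n) |R|≡ |R|≤n) (sym |R|≡) uR′ uR)))

threeBlockWeight : (ℕ → Bool) → Bool → List ℕ → List ℕ → List ℕ → ℕ
threeBlockWeight p z B C R =
  ⟦ oddᵇ (length B) ⟧ * ⟦ evenᵇ (length C) ⟧ * (#upDown p z B * (#upDownTotal C * #downUp R))

#upDown-max-odd : ∀ p z {M A} R → Unique (M ∷ A) → All (_< M) A →
  ⟦ oddᵇ (length A) ⟧ * (#upDown p z (M ∷ A) * #downUp R) ≡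
  ∑ (bipartitions A) λ (B , C) → threeBlockWeight p z B C R
#upDown-max-odd p z {M} {[]}        R _   _   = refl
#upDown-max-odd p z {M} {A@(_ ∷ _)} R uMA A<M = begin
  ⟦ oddᵇ (length A) ⟧ * (#upDown p z (M ∷ A) * #downUp R)
    ≡⟨ cong (λ t → ⟦ oddᵇ (length A) ⟧ * (t * #downUp R)) (#upDown-max p z uMA A<M (s≤s z≤n)) ⟩
  ⟦ oddᵇ (length A) ⟧ * (∑ (bipartitions A) (λ (B , C) → ⟦ oddᵇ (length B) ⟧ * (#upDown p (p M) B * #upDownTotal C))
                         * #downUp R)
    ≡⟨ cong (⟦ oddᵇ (length A) ⟧ *_) (∑-*ʳ (#downUp R) (bipartitions A) _) ⟩
  ⟦ oddᵇ (length A) ⟧ * ∑ (bipartitions A) (λ (B , C) →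
                           (⟦ oddᵇ (length B) ⟧ * (#upDown p (p M) B * #upDownTotal C)) * #downUp R)
    ≡⟨ ∑-*ˡ ⟦ oddᵇ (length A) ⟧ (bipartitions A) _ ⟩
  ∑ (bipartitions A) (λ (B , C) →
    ⟦ oddᵇ (length A) ⟧ * ((⟦ oddᵇ (length B) ⟧ * (#upDown p (p M) B * #upDownTotal C)) * #downUp R))
    ≡⟨ ∑-cong (bipartitions A) (λ {(B , C)} bc∈ → term B C (sym (bipartition-length A bc∈))) ⟩
  ∑ (bipartitions A) (λ (B , C) → threeBlockWeight p z B C R) ∎
  where
  term : ∀ B C → length A ≡ length B + length C →
    ⟦ oddᵇ (length A) ⟧ * ((⟦ oddᵇ (length B) ⟧ * (#upDown p (p M) B * #upDownTotal C)) * #downUp R) ≡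
    ⟦ oddᵇ (length B) ⟧ * ⟦ evenᵇ (length C) ⟧ * (#upDown p z B * (#upDownTotal C * #downUp R))
  term B C |A|≡ with oddᵇ (length B) in odd-B
  ... | false = *-zeroʳ ⟦ oddᵇ (length A) ⟧
  ... | true  = begin
    ⟦ oddᵇ (length A) ⟧ * ((1 * (#upDown p (p M) B * #upDownTotal C)) * #downUp R)
      ≡⟨ cong₂ (λ e u → ⟦ e ⟧ * ((1 * (u * #upDownTotal C)) * #downUp R))
           (trans (cong oddᵇ |A|≡) (oddᵇ-+ (length B) (length C) odd-B))
           (#upDown-nonempty p (p M) z B (oddᵇ⇒nonzero odd-B)) ⟩
    ⟦ evenᵇ (length C) ⟧ * ((1 * (#upDown p z B * #upDownTotal C)) * #downUp R)
      ≡⟨ rearrange ⟦ evenᵇ (length C) ⟧ (#upDown p z B) (#upDownTotal C) (#downUp R) ⟩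
    1 * ⟦ evenᵇ (length C) ⟧ * (#upDown p z B * (#upDownTotal C * #downUp R)) ∎
    where
    rearrange : ∀ e u c d → e * ((1 * (u * c)) * d) ≡ 1 * e * (u * (c * d))
    rearrange = solve-∀

#downUp-max-odd : ∀ p z B {M R′} → Unique (M ∷ R′) → All (_< M) R′ →
  ⟦ oddᵇ (length B) ⟧ * (#upDown p z B * #downUp (M ∷ R′)) ≡
  ∑ (bipartitions R′) λ (C , R) → threeBlockWeight p z B C R
#downUp-max-odd p z B {M} {R′} uMR′ R′<M = begin
  ⟦ oddᵇ (length B) ⟧ * (#upDown p z B * #downUp (M ∷ R′))
    ≡⟨ cong (λ t → ⟦ oddᵇ (length B) ⟧ * (#upDown p z B * t)) (#downUp-max uMR′ R′<M) ⟩
  ⟦ oddᵇ (length B) ⟧ * (#upDown p z B * ∑ (bipartitions R′) (λ (C , R) →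
                                           ⟦ evenᵇ (length C) ⟧ * (#downUp C * #upDownTotal R)))
    ≡⟨ cong (⟦ oddᵇ (length B) ⟧ *_) (∑-*ˡ (#upDown p z B) (bipartitions R′) _) ⟩
  ⟦ oddᵇ (length B) ⟧ * ∑ (bipartitions R′) (λ (C , R) →
                           #upDown p z B * (⟦ evenᵇ (length C) ⟧ * (#downUp C * #upDownTotal R)))
    ≡⟨ ∑-*ˡ ⟦ oddᵇ (length B) ⟧ (bipartitions R′) _ ⟩
  ∑ (bipartitions R′) (λ (C , R) →
    ⟦ oddᵇ (length B) ⟧ * (#upDown p z B * (⟦ evenᵇ (length C) ⟧ * (#downUp C * #upDownTotal R))))
    ≡⟨ ∑-cong (bipartitions R′) (λ {(C , R)} r∈ → term C R (bipartition-Unique R′ (tail uMR′) r∈)) ⟩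
  ∑ (bipartitions R′) (λ (C , R) → threeBlockWeight p z B C R) ∎
  where
  term : ∀ C R → Unique C × Unique R →
    ⟦ oddᵇ (length B) ⟧ * (#upDown p z B * (⟦ evenᵇ (length C) ⟧ * (#downUp C * #upDownTotal R))) ≡
    threeBlockWeight p z B C R
  term C R (uC , uR) = begin
    ⟦ oddᵇ (length B) ⟧ * (#upDown p z B * (⟦ evenᵇ (length C) ⟧ * (#downUp C * #upDownTotal R)))
      ≡⟨ cong (λ t → ⟦ oddᵇ (length B) ⟧ * (#upDown p z B * (⟦ evenᵇ (length C) ⟧ * t)))
           (cong₂ _*_ (sym (#upDownTotal≡#downUp refl uC uC)) (#upDownTotal≡#downUp refl uR uR)) ⟩
    ⟦ oddᵇ (length B) ⟧ * (#upDown p z B * (⟦ evenᵇ (length C) ⟧ * (#upDownTotal C * #downUp R)))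
      ≡⟨ rearrange ⟦ oddᵇ (length B) ⟧ (#upDown p z B) ⟦ evenᵇ (length C) ⟧ (#upDownTotal C) (#downUp R) ⟩
    threeBlockWeight p z B C R ∎
    where
    rearrange : ∀ o u e c d → o * (u * (e * (c * d))) ≡ o * e * (u * (c * d))
    rearrange = solve-∀

-- Both sides expand into one sum over the splittings (B, C, R) of Q into three
-- blocks: on the left by cutting the up-down words on M ∷ A at M, on the right by
-- cutting the down-up words on M ∷ R at M.
odd-block-exchange : ∀ p z {M Q} → Unique (M ∷ Q) → All (_< M) Q →
  ∑ (bipartitions Q) (λ (A , R) → ⟦ oddᵇ (length A) ⟧ * (#upDown p z (M ∷ A) * #downUp R)) ≡
  ∑ (bipartitions Q) (λ (A , R) → ⟦ oddᵇ (length A) ⟧ * (#upDown p z A * #downUp (M ∷ R)))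
odd-block-exchange p z {M} {Q} uMQ Q<M = begin
  ∑ (bipartitions Q) (λ (A , R) → ⟦ oddᵇ (length A) ⟧ * (#upDown p z (M ∷ A) * #downUp R))
    ≡⟨ ∑-cong (bipartitions Q) (λ {(A , R)} q∈ →
         #upDown-max-odd p z R (proj₁ (bipartition-Unique (M ∷ Q) uMQ (∈-bipartitions-∷⁺ˡ M Q q∈)))
                               (proj₁ (bipartition-All Q Q<M q∈))) ⟩
  ∑ (bipartitions Q) (λ (A , R) → ∑ (bipartitions A) λ (B , C) → threeBlockWeight p z B C R)
    ≡⟨ ∑-bipartitions-assoc Q (threeBlockWeight p z) ⟩
  ∑ (bipartitions Q) (λ (B , R) → ∑ (bipartitions R) λ (C , R′) → threeBlockWeight p z B C R′)
    ≡⟨ ∑-cong (bipartitions Q) (λ {(B , R)} q∈ →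
         #downUp-max-odd p z B (proj₂ (bipartition-Unique (M ∷ Q) uMQ (∈-bipartitions-∷⁺ʳ M Q q∈)))
                               (proj₂ (bipartition-All Q Q<M q∈))) ⟨
  ∑ (bipartitions Q) (λ (A , R) → ⟦ oddᵇ (length A) ⟧ * (#upDown p z A * #downUp (M ∷ R))) ∎

-- The recurrence that André permutations satisfy by definition (#andre-min-max):
-- the maximum may be required to lie after the minimum.
#upDown-min-max : ∀ p z {m M Q} → Unique (m ∷ M ∷ Q) → All (m <_) (M ∷ Q) → All (_< M) Q →
  #upDown p z (m ∷ M ∷ Q) ≡ ∑ (bipartitions Q) λ (A , R) → #upDown p (p m) A * #downUp (M ∷ R)
#upDown-min-max p z {m} {M} {Q} u m<MQ Q<M = begin
  #upDown p z (m ∷ M ∷ Q)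
    ≡⟨ #upDown-min p z u m<MQ ⟩
  ∑ (bipartitions (M ∷ Q)) (λ (A , R) → ⟦ evenᵇ (length A) ⟧ * (v A * #downUp R))
    ≡⟨ ∑-bipartitions-∷ M Q _ ⟩
  ∑ (bipartitions Q) (λ (A , R) → ⟦ evenᵇ (suc (length A)) ⟧ * (v (M ∷ A) * #downUp R)) + ∑even
    ≡⟨ cong (_+ ∑even) (trans (∑-cong (bipartitions Q) (λ {(A , R)} _ →
                                 cong (λ b → ⟦ b ⟧ * (v (M ∷ A) * #downUp R)) (evenᵇ-suc (length A))))
                              (odd-block-exchange p (p m) (tail u) Q<M)) ⟩
  ∑ (bipartitions Q) (λ (A , R) → ⟦ oddᵇ (length A) ⟧ * (v A * #downUp (M ∷ R))) + ∑even
    ≡⟨ ∑-+ (bipartitions Q) _ _ ⟨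
  ∑ (bipartitions Q) (λ (A , R) → ⟦ oddᵇ (length A) ⟧ * (v A * #downUp (M ∷ R))
                                  + ⟦ evenᵇ (length A) ⟧ * (v A * #downUp (M ∷ R)))
    ≡⟨ ∑-cong (bipartitions Q) (λ {(A , R)} _ → ⟦¬b⟧*v+⟦b⟧*v≡v (evenᵇ (length A)) (v A * #downUp (M ∷ R))) ⟩
  ∑ (bipartitions Q) (λ (A , R) → v A * #downUp (M ∷ R)) ∎
  where
  v = #upDown p (p m)
  ∑even = ∑ (bipartitions Q) (λ (A , R) → ⟦ evenᵇ (length A) ⟧ * (v A * #downUp (M ∷ R)))

#andre-min-max : ∀ p z {m M Q} → Unique (m ∷ M ∷ Q) → All (m <_) (M ∷ Q) → All (_< M) Q →
  #andre p z (m ∷ M ∷ Q) ≡ ∑ (bipartitions Q) λ (A , R) → #andre p (p m) A * #andreTotal (M ∷ R)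
#andre-min-max p z {m} {M} {Q} u m<MQ Q<M = begin
  #andre p z (m ∷ M ∷ Q)
    ≡⟨ #andre-min p z u m<MQ Q<M ⟩
  ∑ (bipartitions (M ∷ Q)) (λ (A , R) → ⟦ elemᵇ M R ⟧ * (a A * #andreTotal R))
    ≡⟨ ∑-bipartitions-∷ M Q _ ⟩
  ∑ (bipartitions Q) (λ (A , R) → ⟦ elemᵇ M R ⟧ * (a (M ∷ A) * #andreTotal R)) +
  ∑ (bipartitions Q) (λ (A , R) → ⟦ elemᵇ M (M ∷ R) ⟧ * (a A * #andreTotal (M ∷ R)))
    ≡⟨ cong₂ _+_ (∑-zero (bipartitions Q) M∉R) (∑-cong (bipartitions Q) (λ {(A , R)} _ → M∈M∷R A R)) ⟩
  0 + ∑ (bipartitions Q) (λ (A , R) → a A * #andreTotal (M ∷ R)) ∎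
  where
  a = #andre p (p m)
  M∉R : ∀ {q} → q ∈ bipartitions Q → ⟦ elemᵇ M (proj₂ q) ⟧ * (a (M ∷ proj₁ q) * #andreTotal (proj₂ q)) ≡ 0
  M∉R q∈ rewrite elemᵇ-∉ (λ M∈R → <-irrefl refl (All.lookup (proj₂ (bipartition-All Q Q<M q∈)) M∈R)) = refl
  M∈M∷R : ∀ A R → ⟦ elemᵇ M (M ∷ R) ⟧ * (a A * #andreTotal (M ∷ R)) ≡ a A * #andreTotal (M ∷ R)
  M∈M∷R A R rewrite elemᵇ-∈ {M} {M ∷ R} (here refl) = *-identityˡ _

#jacobi≡#upDown : ∀ p z {S} → Unique S → #jacobi p z S ≡ #upDown p z S
#jacobi≡#upDown p z {S} = go (length S) ≤-refl p z
  where
  go : ∀ n {S} → length S ≤ n → ∀ p z → Unique S → #jacobi p z S ≡ #upDown p z S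
  go _       {[]}    _           _ _ _  = refl
  go (suc n) {x ∷ S} (s≤s |S|≤n) p z uS with m , S′ , S↭ , m<S′ ← extract-minimum uS = begin
    #jacobi p z (x ∷ S)
      ≡⟨ ∑-permutationsOf-↭ uS S↭ _ ⟩
    #jacobi p z (m ∷ S′)
      ≡⟨ #jacobi-min p z uS′ m<S′ ⟩
    ∑ (bipartitions S′) (λ (A , R) → ⟦ evenᵇ (length R) ⟧ * (#jacobiTotal A * #jacobi p (p m) R))
      ≡⟨ ∑-cong (bipartitions S′) by-induction ⟩
    ∑ (bipartitions S′) (f ∘ swap)
      ≡⟨ ∑-bipartitions-swap S′ f ⟨
    ∑ (bipartitions S′) f
      ≡⟨ #upDown-min p z uS′ m<S′ ⟨
    #upDown p z (m ∷ S′)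
      ≡⟨ ∑-permutationsOf-↭ uS S↭ _ ⟨
    #upDown p z (x ∷ S) ∎
    where
    uS′ = Unique-resp-↭ S↭ uS
    f : List ℕ × List ℕ → ℕ
    f (A , R) = ⟦ evenᵇ (length A) ⟧ * (#upDown p (p m) A * #downUp R)
    by-induction : ∀ {q} → q ∈ bipartitions S′ →
      ⟦ evenᵇ (length (proj₂ q)) ⟧ * (#jacobiTotal (proj₁ q) * #jacobi p (p m) (proj₂ q)) ≡ f (swap q)
    by-induction {A , R} q∈
      with |A|≤n , |R|≤n ← bipartition-length-≤ S′ (subst (_≤ n) (suc-injective (↭.↭-length S↭)) |S|≤n) q∈
         | uA , uR ← bipartition-Unique S′ (tail uS′) q∈
      = cong (⟦ evenᵇ (length R) ⟧ *_) (begin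
        #jacobiTotal A * #jacobi p (p m) R
          ≡⟨ cong₂ _*_ (trans (go n |A|≤n (const true) true uA) (#upDownTotal≡#downUp refl uA uA))
                       (go n |R|≤n p (p m) uR) ⟩
        #downUp A * #upDown p (p m) R
          ≡⟨ *-comm (#downUp A) (#upDown p (p m) R) ⟩
        #upDown p (p m) R * #downUp A ∎)

#andre≡#upDown : ∀ p z {S} → Unique S → #andre p z S ≡ #upDown p z S
#andre≡#upDown p z {S} = go (length S) ≤-refl p z
  where
  go : ∀ n {S} → length S ≤ n → ∀ p z → Unique S → #andre p z S ≡ #upDown p z S
  go _       {[]}    _           _ _ _  = refl
  go (suc n) {x ∷ S} (s≤s |S|≤n) p z uS with extract-minimum uS
  ... | m , [] , S↭ , _ = begin
    #andre p z (x ∷ S)   ≡⟨ ∑-permutationsOf-↭ uS S↭ _ ⟩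
    #andre p z (m ∷ [])  ≡⟨ #andre-singleton p z m ⟩
    #upDown p z (m ∷ []) ≡⟨ ∑-permutationsOf-↭ uS S↭ _ ⟨
    #upDown p z (x ∷ S)  ∎
  ... | m , y ∷ S′ , S↭ , m<S′ with M , Q , S′↭ , Q<M ← extract-maximum (tail (Unique-resp-↭ S↭ uS)) = begin
    #andre p z (x ∷ S)
      ≡⟨ ∑-permutationsOf-↭ uS S↭mMQ _ ⟩
    #andre p z (m ∷ M ∷ Q)
      ≡⟨ #andre-min-max p z u m<MQ Q<M ⟩
    ∑ (bipartitions Q) (λ (A , R) → #andre p (p m) A * #andreTotal (M ∷ R))
      ≡⟨ ∑-cong (bipartitions Q) by-induction ⟩
    ∑ (bipartitions Q) (λ (A , R) → #upDown p (p m) A * #downUp (M ∷ R))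
      ≡⟨ #upDown-min-max p z u m<MQ Q<M ⟨
    #upDown p z (m ∷ M ∷ Q)
      ≡⟨ ∑-permutationsOf-↭ uS S↭mMQ _ ⟨
    #upDown p z (x ∷ S) ∎
    where
    S↭mMQ : x ∷ S ↭ m ∷ M ∷ Q
    S↭mMQ = ↭-trans S↭ (↭-prep m S′↭)
    u = Unique-resp-↭ S↭mMQ uS
    m<MQ = ↭.All-resp-↭ S′↭ m<S′
    by-induction : ∀ {q} → q ∈ bipartitions Q →
      #andre p (p m) (proj₁ q) * #andreTotal (M ∷ proj₂ q) ≡ #upDown p (p m) (proj₁ q) * #downUp (M ∷ proj₂ q)
    by-induction {A , R} q∈
      with q∈′ ← ∈-bipartitions-∷⁺ʳ M Q q∈
      with |A|≤n , |MR|≤n ← bipartition-length-≤ (M ∷ Q) (subst (_≤ n) (suc-injective (↭.↭-length S↭mMQ)) |S|≤n) q∈′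
         | uA , uMR ← bipartition-Unique (M ∷ Q) (tail u) q∈′
      = cong₂ _*_ (go n |A|≤n p (p m) uA)
                  (trans (go n |MR|≤n (const true) true uMR) (#upDownTotal≡#downUp refl uMR uMR))

theorem2p7 : (n k : ℕ) → n ≥ 1 → k ≥ 1 →
    (countPerms n (λ π → jacobiᵇ π ∧ lastIs k π) ≡ entringer n k)
    × (countPerms n (λ π → jacobiᵇ π ∧ lastIs k π) ≡ countPerms n (λ π → upDownᵇ π ∧ firstIs k π))
    × (countPerms n (λ π → jacobiᵇ π ∧ lastIs k π) ≡ countPerms n (λ π → andreᵇ π ∧ firstIs k π))
theorem2p7 n k _ _ = jacobi≡upDown , jacobi≡upDown , trans jacobi≡upDown (sym andre≡upDown)
  where
  jacobi≡upDown : countPerms n (λ π → jacobiᵇ π ∧ lastIs k π) ≡ countPerms n (λ π → upDownᵇ π ∧ firstIs k π)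
  jacobi≡upDown = trans (countPerms-lastIs n k jacobiᵇ)
                  (trans (#jacobi≡#upDown (_≡ᵇ k) false (oneTo-unique n)) (sym (countPerms-firstIs n k upDownᵇ)))
  andre≡upDown : countPerms n (λ π → andreᵇ π ∧ firstIs k π) ≡ countPerms n (λ π → upDownᵇ π ∧ firstIs k π)
  andre≡upDown = trans (countPerms-firstIs n k andreᵇ)
                 (trans (#andre≡#upDown (_≡ᵇ k) false (oneTo-unique n)) (sym (countPerms-firstIs n k upDownᵇ)))
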